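{- Let $1<n\le m$ and let $v$ be a vertex of $Z_{n,m}$ with $h(v)\ge h_{n,m}$ and $\sum_{i\in I_c(v)}v_i=n$. Then $d(v,0)\le d_{n,m}$.
   Context: Elements of $\mathbb{Z}_n$ are identified with their smallest nonnegative representatives in $\{0,\dots,n-1\}$ (so $v_0,v_{m+1}$ are integers in $[0,n-1]$ in sums). The dYoke graph $Z_{n,m}$ has as vertices all tuples $u=(u_0,\dots,u_{m+1})$ with $u_0,u_{m+1}\in\mathbb{Z}_n$, $u_1,\dots,u_m\in\{ -1,0,1\}$ and $\sum_{i=0}^{m+1}u_i\equiv0\pmod n$; adjacency: there is $0\le i\le m$ with $u_j=v_j$ for $j\notin\{i,i+1\}$ and either ($u_i=v_i+1$, $u_{i+1}=v_{i+1}-1$) or ($u_i=v_i-1$, $u_{i+1}=v_{i+1}+1$), arithmetic in coordinates $0,m+1$ in $\mathbb{Z}_n$. $0$ is the all-zero vertex, $d$ is graph distance. A pivot of $v$ is an integer $-1\le p\le m+1$ such that $n\mid\sum_{i=0}^{p}v_i$ (empty sum $=0$); $\operatorname{Piv}(v)$ is the set of pivots. $p_l(v)=\max\{p\in\operatorname{Piv}(v):p<\frac m2\}$, $p_r(v)=\min\{p\in\operatorname{Piv}(v):p\ge\frac m2\}$, $I_c(v)=[p_l(v)+1,p_r(v)]$. $h(v)=\min\{|p-\frac m2|:p\in\operatorname{Piv}(v)\}$; $h_{n,m}=\frac n2$ if $2\mid(m-n)$ and $\frac{n+1}{2}$ otherwise. $u^0_{n,m}$ is the vertex with $u_i=1$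 for $1\le i\le m$ and $u_0\equiv-\lfloor\frac{m-n}{2}\rfloor\pmod n$; $d^0_{n,m}=d(u^0_{n,m},0)$. For $n<m$ with $m-n$ odd, $u^1_{n,m}$ is the vertex with $u_{\lceil(m+1)/2\rceil}=0$, $u_i=1$ for the other $1\le i\le m$, $u_0\equiv-\lfloor\frac{m-n}{2}\rfloor\pmod n$; $d^1_{n,m}=d(u^1_{n,m},0)$. $d_{n,m}=d^0_{n,m}$ if $2\mid(m-n)$ and $\max\{d^0_{n,m},d^1_{n,m}\}$ otherwise. -}

module Defs where

open import Data.Nat as ℕ using (ℕ; zero; suc; NonZero)
import Data.Nat.Divisibility as ℕD
open import Data.Integer as ℤ using (ℤ; +_; -_; _+_; _-_; ∣_∣; _⊔_; _⊓_)
open import Data.Integer.DivMod using (_%ℕ_)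
open import Data.Fin as Fin using (Fin; toℕ)
open import Data.Vec as Vec using (Vec; lookup; tabulate)
open import Data.List as List using (List; filter; map; upTo; zip; foldr)
open import Data.Product using (Σ; ∃; ∃-syntax; _×_; _,_; proj₁; proj₂)
open import Data.Sum using (_⊎_)
open import Relation.Nullary using (¬_; _×-dec_)
open import Relation.Unary using (Decidable)
open import Relation.Binary.PropositionalEquality using (_≡_)
open import Data.Bool using (if_then_else_)

-- Tuples u = (u_0, …, u_{m+1}) are vectors of 2+m integers; index i of
-- the vector is coordinate u_i.  Elements of ℤ_n (coordinates 0, m+1)
-- are their representatives in {0,…,n-1}.

Tuple : ℕ → Set
Tuple m = Vec ℤ (suc (suc m))

IsEnd : (m : ℕ) → Fin (suc (suc m)) → Set
IsEnd m i = toℕ i ≡ 0 ⊎ toℕ i ≡ suc m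

_∣ℤ_ : ℕ → ℤ → Set
n ∣ℤ x = n ℕD.∣ ∣ x ∣

coords : ∀ {m} → Tuple m → List (ℤ × ℤ)
coords {m} u = zip (map +_ (upTo (suc (suc m)))) (Vec.toList u)

sumOver : ∀ {m} {P : ℤ → Set} → Decidable P → Tuple m → ℤ
sumOver P? u = foldr _+_ (+ 0) (map proj₂ (filter (λ c → P? (proj₁ c)) (coords u)))

sumFromTo : ∀ {m} → ℤ → ℤ → Tuple m → ℤ
sumFromTo a b u = sumOver (λ i → (a ℤ.≤? i) ×-dec (i ℤ.≤? b)) u

IsVertex : (n m : ℕ) → Tuple m → Set
IsVertex n m u =
  (∀ i → IsEnd m i → (+ 0 ℤ.≤ lookup u i) × (lookup u i ℤ.< + n)) ×
  (∀ i → ¬ IsEnd m i → (lookup u i ≡ ℤ.-1ℤ ⊎ lookup u i ≡ + 0 ⊎ lookup u i ≡ + 1)) ×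
  (n ∣ℤ sumFromTo (+ 0) (+ suc m) u)

-- equality of coordinate i after a step: in ℤ_n for end coordinates,
-- in ℤ for the middle coordinates
CoordEq : (n m : ℕ) → Fin (suc (suc m)) → ℤ → ℤ → Set
CoordEq n m i a b = (IsEnd m i → n ∣ℤ (a - b)) × (¬ IsEnd m i → a ≡ b)

Adj : (n m : ℕ) → Tuple m → Tuple m → Set
Adj n m u v = ∃[ i ] ∃[ δ ] (i ℕ.≤ m) × (δ ≡ + 1 ⊎ δ ≡ ℤ.-1ℤ) ×
  (∀ j → (toℕ j ≢ i → toℕ j ≢ suc i → lookup u j ≡ lookup v j) ×
         (toℕ j ≡ i → CoordEq n m j (lookup u j) (lookup v j + δ)) ×
         (toℕ j ≡ suc i → CoordEq n m j (lookup u j) (lookup v j - δ)))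
  where
  _≢_ : ℕ → ℕ → Set
  a ≢ b = ¬ (a ≡ b)

data Walk (n m : ℕ) : Tuple m → Tuple m → ℕ → Set where
  here : ∀ {u} → IsVertex n m u → Walk n m u u 0
  step : ∀ {u v w k} → IsVertex n m u → Adj n m u v → Walk n m v w k →
         Walk n m u w (suc k)

DistLe : (n m : ℕ) → Tuple m → Tuple m → ℕ → Set
DistLe n m u w k = ∃[ j ] (j ℕ.≤ k) × Walk n m u w j

IsDist : (n m : ℕ) → Tuple m → Tuple m → ℕ → Set
IsDist n m u w k = Walk n m u w k × (∀ j → Walk n m u w j → k ℕ.≤ j)

zeroV : (m : ℕ) → Tuple m
zeroV m = Vec.replicate _ (+ 0)

PivotCond : (n : ℕ) → ∀ {m} → Tuple m → ℤ → Set
PivotCond n u p = n ∣ℤ sumFromTo (+ 0) p u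

pivotCond? : (n : ℕ) → ∀ {m} (u : Tuple m) → Decidable (PivotCond n u)
pivotCond? n u p = n ℕD.∣? ∣ sumFromTo (+ 0) p u ∣

candidates : ℕ → List ℤ
candidates m = map (λ q → + q - + 1) (upTo (suc (suc (suc m))))

Piv : (n : ℕ) → ∀ {m} → Tuple m → List ℤ
Piv n {m} u = filter (pivotCond? n u) (candidates m)

-- p_l(u) = max{p ∈ Piv(u) : p < m/2}   (i.e. 2p < m).
-- The fold starts at −1, which is always a pivot and the least candidate.
pl : (n m : ℕ) → Tuple m → ℤ
pl n m u = foldr _⊔_ ℤ.-1ℤ (filter (λ p → (+ 2 ℤ.* p) ℤ.<? + m) (Piv n u))

-- p_r(u) = min{p ∈ Piv(u) : p ≥ m/2}   (i.e. 2p ≥ m).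
-- The fold starts at m+1, which is a pivot of every vertex and the largest candidate.
pr : (n m : ℕ) → Tuple m → ℤ
pr n m u = foldr _⊓_ (+ suc m) (filter (λ p → + m ℤ.≤? (+ 2 ℤ.* p)) (Piv n u))

sumIc : (n m : ℕ) → Tuple m → ℤ
sumIc n m u = sumFromTo (pl n m u + + 1) (pr n m u) u

-- 2·h(u) = min{ |2p − m| : p ∈ Piv(u) }
-- (the fold starts at |2·(−1) − m|, the value at the pivot −1)
h2 : (n m : ℕ) → Tuple m → ℕ
h2 n m u = foldr ℕ._⊓_ ∣ + 2 ℤ.* ℤ.-1ℤ - + m ∣ (map (λ p → ∣ + 2 ℤ.* p - + m ∣) (Piv n u))

evenCase : ∀ {a} {A : Set a} → ℕ → A → A → A
evenCase zero x y = x
evenCase (suc zero) x y = y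
evenCase (suc (suc k)) x y = evenCase k x y

-- 2·h_{n,m}: n if 2 ∣ (m − n), n+1 otherwise  (here n ≤ m)
h2nm : (n m : ℕ) → ℕ
h2nm n m = evenCase (m ℕ.∸ n) n (suc n)

startVal : (n m : ℕ) → .{{NonZero n}} → ℤ
startVal n m = + ((- + ((m ℕ.∸ n) ℕ./ 2)) %ℕ n)

-- u⁰: u_i = 1 for 1 ≤ i ≤ m, u_0 ≡ −⌊(m−n)/2⌋, and u_{m+1} the unique
-- element of ℤ_n making the coordinate sum ≡ 0 (mod n)
u⁰ : (n m : ℕ) → .{{NonZero n}} → Tuple m
u⁰ n m = tabulate f
  where
  a = startVal n m
  b = + ((- (a + + m)) %ℕ n)
  f : Fin (suc (suc m)) → ℤ
  f i = if toℕ i ℕ.≡ᵇ 0 then a else (if toℕ i ℕ.≡ᵇ suc m then b else + 1)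

-- u¹ (used when m − n is odd): u_{⌈(m+1)/2⌉} = 0, u_i = 1 for the other
-- 1 ≤ i ≤ m, u_0 ≡ −⌊(m−n)/2⌋, u_{m+1} making the sum ≡ 0 (mod n)
u¹ : (n m : ℕ) → .{{NonZero n}} → Tuple m
u¹ n m = tabulate f
  where
  a = startVal n m
  b = + ((- (a + + m - + 1)) %ℕ n)
  c = (suc (suc m)) ℕ./ 2   -- ⌈(m+1)/2⌉
  f : Fin (suc (suc m)) → ℤ
  f i = if toℕ i ℕ.≡ᵇ 0 then a else (if toℕ i ℕ.≡ᵇ suc m then b else
        (if toℕ i ℕ.≡ᵇ c then + 0 else + 1))

IsDnm : (n m : ℕ) → .{{NonZero n}} → ℕ → Set
IsDnm n m k = evenCase (m ℕ.∸ n)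
  (IsDist n m (u⁰ n m) (zeroV m) k)
  (∃[ d0 ] ∃[ d1 ] IsDist n m (u⁰ n m) (zeroV m) d0 ×
                   IsDist n m (u¹ n m) (zeroV m) d1 × (k ≡ d0 ℕ.⊔ d1))

module Submission where

-- Distances are controlled by the partial sums T_v(q) = v_0 + … + v_{q-1} through the cost
-- C(v, j) = Σ_{p=0}^{m} |T_v(p+1) − j·n|:  d(v, 0) = min_j C(v, j).  An edge changes the partial
-- sums by a common multiple of n and by ±1 at one place, which gives the lower bound; moving
-- an extreme partial sum one unit towards j·n is an edge, which gives the upper bound.
--
-- The hypotheses on v say that its pivots p_l ≤ t and p_r ≥ t + n + e are consecutive, where
-- m = n + 2t + e (e ∈ {0,1}), and that the partial sums rise by exactly n between them.  Hence,
-- measured from T_v(p_l + 1) = k·n, each partial sum lies in a zone: in [0, n], or near 0 before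
-- p_l, or near n after p_r.  The extremal vertex u = u⁰ (e = 0) or u¹ (e = 1) has a reference
-- profile X on the boundary of these zones with X_p + X_{m−p} = n (+1 once).  With
-- g(x) = |x| + |x − n| this yields
--   C(v, k) + C(v, k+1) = Σ g(y_p) ≤ Σ g(X_p) ≤ 2·C(u, j) + 1,
-- so min(C(v, k), C(v, k+1)) ≤ C(u, j) ≤ d(u, 0) ≤ d_{n,m}.

open import Defs
open import Data.Nat using (ℕ; _<_; _≤_; NonZero)
open import Data.Integer using (+_)
open import Relation.Binary.PropositionalEquality using (_≡_)
open import Data.Nat as ℕ using (zero; suc; z≤n; s≤s; _∸_)
import Data.Nat.Properties as ℕP
import Data.Nat.Divisibility as ℕD
import Data.Nat.DivMod as ℕDM
open import Data.Nat.Tactic.RingSolver renaming (solve-∀ to solveℕ)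
open import Data.Integer as ℤ using (ℤ; -[1+_]; -_; _+_; _-_; _*_; ∣_∣; _⊔_; _⊓_; _⊖_)
import Data.Integer.Properties as ℤP
open import Data.Integer.DivMod using (_%ℕ_; _/ℕ_)
import Data.Integer.DivMod as ℤDM
open import Data.Integer.Tactic.RingSolver using (solve-∀)
open import Data.Fin as Fin using (Fin; toℕ)
import Data.Fin.Properties as FinP
open import Data.Vec as Vec using (Vec; lookup; tabulate)
import Data.Vec.Properties as VecP
open import Data.List as List using (List; []; _∷_)
open import Data.List.Membership.Propositional using (_∈_)
import Data.List.Membership.Propositional.Properties as ∈P
import Data.List.Relation.Unary.Any as Any
open import Data.Product using (∃; ∃-syntax; _×_; _,_; proj₁; proj₂)
open import Data.Sum using (_⊎_; inj₁; inj₂)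
open import Data.Empty using (⊥; ⊥-elim)
open import Data.Bool using (true; false; if_then_else_)
open import Relation.Nullary using (¬_; Dec; yes; no)
open import Relation.Nullary.Decidable using (_×-dec_)
open import Relation.Unary using (Decidable)
open import Relation.Binary.PropositionalEquality using (refl; sym; trans; cong; cong₂; subst; subst₂; module ≡-Reasoning)
open import Function using (_∘_)


Σℤ : (ℕ → ℤ) → ℕ → ℤ
Σℤ F zero = + 0
Σℤ F (suc N) = Σℤ F N + F N

Σℕ : (ℕ → ℕ) → ℕ → ℕ
Σℕ F zero = 0
Σℕ F (suc N) = Σℕ F N ℕ.+ F N

Σℤ-cons : ∀ F N → Σℤ F (suc N) ≡ F 0 + Σℤ (F ∘ suc) N
Σℤ-cons F zero = ℤP.+-comm (+ 0) (F 0)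
Σℤ-cons F (suc N) =
  trans (cong (_+ F (suc N)) (Σℤ-cons F N)) (ℤP.+-assoc (F 0) (Σℤ (F ∘ suc) N) (F (suc N)))

Σℕ-cons : ∀ F N → Σℕ F (suc N) ≡ F 0 ℕ.+ Σℕ (F ∘ suc) N
Σℕ-cons F zero = ℕP.+-comm 0 (F 0)
Σℕ-cons F (suc N) =
  trans (cong (ℕ._+ F (suc N)) (Σℕ-cons F N)) (ℕP.+-assoc (F 0) (Σℕ (F ∘ suc) N) (F (suc N)))

Σℤ-cong : ∀ {F G} N → (∀ i → i < N → F i ≡ G i) → Σℤ F N ≡ Σℤ G N
Σℤ-cong zero h = refl
Σℤ-cong (suc N) h = cong₂ _+_ (Σℤ-cong N (λ i i<N → h i (ℕP.m<n⇒m<1+n i<N))) (h N ℕP.≤-refl)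

Σℕ-cong : ∀ {F G} N → (∀ i → i < N → F i ≡ G i) → Σℕ F N ≡ Σℕ G N
Σℕ-cong zero h = refl
Σℕ-cong (suc N) h = cong₂ ℕ._+_ (Σℕ-cong N (λ i i<N → h i (ℕP.m<n⇒m<1+n i<N))) (h N ℕP.≤-refl)

Σℕ-mono : ∀ {F G} N → (∀ i → i < N → F i ≤ G i) → Σℕ F N ≤ Σℕ G N
Σℕ-mono zero h = z≤n
Σℕ-mono (suc N) h = ℕP.+-mono-≤ (Σℕ-mono N (λ i i<N → h i (ℕP.m<n⇒m<1+n i<N))) (h N ℕP.≤-refl)

Σℕ-zero : ∀ F N → (∀ i → F i ≡ 0) → Σℕ F N ≡ 0
Σℕ-zero F zero h = refl
Σℕ-zero F (suc N) h = cong₂ ℕ._+_ (Σℕ-zero F N h) (h N)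

Σℕ-+ : ∀ F G N → Σℕ (λ i → F i ℕ.+ G i) N ≡ Σℕ F N ℕ.+ Σℕ G N
Σℕ-+ F G zero = refl
Σℕ-+ F G (suc N) = trans (cong (ℕ._+ (F N ℕ.+ G N)) (Σℕ-+ F G N)) (interchange (Σℕ F N) (Σℕ G N) (F N) (G N))
  where
  interchange : ∀ a b c d → a ℕ.+ b ℕ.+ (c ℕ.+ d) ≡ a ℕ.+ c ℕ.+ (b ℕ.+ d)
  interchange = solveℕ

Σℤ-+ : ∀ F G N → Σℤ (λ i → F i + G i) N ≡ Σℤ F N + Σℤ G N
Σℤ-+ F G zero = refl
Σℤ-+ F G (suc N) = trans (cong (_+ (F N + G N)) (Σℤ-+ F G N)) (interchange (Σℤ F N) (Σℤ G N) (F N) (G N))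
  where
  interchange : ∀ a b c d → a + b + (c + d) ≡ a + c + (b + d)
  interchange = solve-∀

Σℤ-neg : ∀ F N → Σℤ (λ i → - F i) N ≡ - Σℤ F N
Σℤ-neg F zero = refl
Σℤ-neg F (suc N) = trans (cong (_+ - F N) (Σℤ-neg F N)) (sym (ℤP.neg-distrib-+ (Σℤ F N) (F N)))

Σℕ-reflect : ∀ F m → Σℕ F (suc m) ≡ Σℕ (λ p → F (m ∸ p)) (suc m)
Σℕ-reflect F zero = refl
Σℕ-reflect F (suc m) = begin
    Σℕ F (suc m) ℕ.+ F (suc m)                        ≡⟨ cong (ℕ._+ F (suc m)) (Σℕ-reflect F m) ⟩
    Σℕ (λ p → F (m ∸ p)) (suc m) ℕ.+ F (suc m)        ≡⟨ ℕP.+-comm _ (F (suc m)) ⟩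
    F (suc m) ℕ.+ Σℕ (λ p → F (m ∸ p)) (suc m)        ≡⟨ Σℕ-cons (λ p → F (suc m ∸ p)) (suc m) ⟨
    Σℕ (λ p → F (suc m ∸ p)) (suc (suc m))             ∎
  where open ≡-Reasoning

ind : ℕ → ℕ → ℕ
ind c i with i ℕ.≟ c
... | yes _ = 1
... | no _ = 0

ind-ne : ∀ c i → ¬ (i ≡ c) → ind c i ≡ 0
ind-ne c i ne with i ℕ.≟ c
... | yes e = ⊥-elim (ne e)
... | no _ = refl

ind-eq : ∀ c → ind c c ≡ 1
ind-eq c with c ℕ.≟ c
... | yes _ = refl
... | no ne = ⊥-elim (ne refl)

ind-shift : ∀ c i → ind (suc c) (suc i) ≡ ind c i
ind-shift c i with i ℕ.≟ c
... | yes refl = ind-eq (suc c)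
... | no ne = ind-ne (suc c) (suc i) (ne ∘ ℕP.suc-injective)

Σind-below : ∀ c N → N ≤ c → Σℕ (ind c) N ≡ 0
Σind-below c zero _ = refl
Σind-below c (suc N) N<c = cong₂ ℕ._+_ (Σind-below c N (ℕP.<⇒≤ N<c)) (ind-ne c N (ℕP.<⇒≢ N<c))

Σind-above : ∀ c N → c < N → Σℕ (ind c) N ≡ 1
Σind-above c (suc N) c<1+N with N ℕ.≟ c
... | yes refl = cong (ℕ._+ 1) (Σind-below c c ℕP.≤-refl)
... | no ne = cong₂ ℕ._+_ (Σind-above c N (ℕP.≤∧≢⇒< (ℕP.≤-pred c<1+N) (ne ∘ sym))) refl

Σind≤1 : ∀ c N → Σℕ (ind c) N ≤ 1
Σind≤1 c N with N ℕ.≤? c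
... | yes N≤c = ℕP.≤-trans (ℕP.≤-reflexive (Σind-below c N N≤c)) z≤n
... | no N≰c = ℕP.≤-reflexive (Σind-above c N (ℕP.≰⇒> N≰c))

-- the i-th entry of a list, 0 past its end
at : List ℤ → ℕ → ℤ
at [] _ = + 0
at (x ∷ xs) zero = x
at (x ∷ xs) (suc i) = at xs i

-- co u i = u_i, and the prefix sum T u q = u_0 + … + u_{q-1}
co : ∀ {m} → Tuple m → ℕ → ℤ
co u = at (Vec.toList u)

T : ∀ {m} → Tuple m → ℕ → ℤ
T u = Σℤ (co u)

at-lookup : ∀ {N} (v : Vec ℤ N) (i : Fin N) → at (Vec.toList v) (toℕ i) ≡ lookup v i
at-lookup (x Vec.∷ v) Fin.zero = refl
at-lookup (x Vec.∷ v) (Fin.suc i) = at-lookup v i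

co-lookup : ∀ {m} (u : Tuple m) r (r< : r < suc (suc m)) → lookup u (Fin.fromℕ< r<) ≡ co u r
co-lookup u r r< = trans (sym (at-lookup u (Fin.fromℕ< r<))) (cong (co u) (FinP.toℕ-fromℕ< r<))

co-tabulate : ∀ {m} (f : Fin (suc (suc m)) → ℤ) r (r< : r < suc (suc m)) →
              co (tabulate f) r ≡ f (Fin.fromℕ< r<)
co-tabulate f r r< = trans (sym (co-lookup (tabulate f) r r<)) (VecP.lookup∘tabulate f (Fin.fromℕ< r<))

tabulate-co : ∀ {m} (u : Tuple m) (f : ℕ → ℤ) → (∀ r → r < suc (suc m) → f r ≡ co u r) →
              tabulate (λ j → f (toℕ j)) ≡ u
tabulate-co u f h =
  trans (VecP.tabulate-cong (λ j → trans (h (toℕ j) (FinP.toℕ<n j)) (at-lookup u j))) (VecP.tabulate∘lookup u)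

T-zeroV : ∀ m q → T (zeroV m) q ≡ + 0
T-zeroV m zero = refl
T-zeroV m (suc q) = trans (cong₂ _+_ (T-zeroV m q) (zero-entry (suc (suc m)) q)) refl
  where
  zero-entry : ∀ N r → at (Vec.toList (Vec.replicate N (+ 0))) r ≡ + 0
  zero-entry zero r = refl
  zero-entry (suc N) zero = refl
  zero-entry (suc N) (suc r) = zero-entry N r

sel : {P : Set} → Dec P → ℤ → ℤ
sel (yes _) x = x
sel (no _) x = + 0

sel-iff : {P Q : Set} → (P → Q) → (Q → P) → (d : Dec P) (d′ : Dec Q) → ∀ x → sel d x ≡ sel d′ x
sel-iff f g (yes p) (yes q) x = refl
sel-iff f g (yes p) (no ¬q) x = ⊥-elim (¬q (f p))
sel-iff f g (no ¬p) (yes q) x = ⊥-elim (¬p (g q))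
sel-iff f g (no ¬p) (no ¬q) x = refl

filteredSum : {P : ℤ → Set} → Decidable P → List (ℤ × ℤ) → ℤ
filteredSum P? cs = List.foldr _+_ (+ 0) (List.map proj₂ (List.filter (λ c → P? (proj₁ c)) cs))

filteredSum-Σ : {P : ℤ → Set} (P? : Decidable P) (f : ℕ → ℕ) (N : ℕ) (ys : List ℤ) →
  filteredSum P? (List.zip (List.map +_ (List.applyUpTo f N)) ys) ≡ Σℤ (λ i → sel (P? (+ f i)) (at ys i)) N
filteredSum-Σ P? f zero ys = refl
filteredSum-Σ P? f (suc N) [] = sym (trans (Σℤ-cong (suc N) (λ i _ → sel-0 (P? (+ f i)))) (Σℤ-zero (suc N)))
  where
  sel-0 : {P : Set} (d : Dec P) → sel d (+ 0) ≡ + 0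
  sel-0 (yes _) = refl
  sel-0 (no _) = refl
  Σℤ-zero : ∀ N → Σℤ (λ _ → + 0) N ≡ + 0
  Σℤ-zero zero = refl
  Σℤ-zero (suc N) = cong (_+ + 0) (Σℤ-zero N)
filteredSum-Σ P? f (suc N) (y ∷ ys)
  rewrite Σℤ-cons (λ i → sel (P? (+ f i)) (at (y ∷ ys) i)) N with P? (+ f 0)
... | yes _ = cong (λ z → y + z) (filteredSum-Σ P? (f ∘ suc) N ys)
... | no _ = trans (filteredSum-Σ P? (f ∘ suc) N ys) (sym (ℤP.+-identityˡ _))

sumFromTo-Σ : ∀ {m} a b (u : Tuple m) →
  sumFromTo a b u ≡ Σℤ (λ i → sel ((a ℤ.≤? + i) ×-dec (+ i ℤ.≤? b)) (co u i)) (suc (suc m))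
sumFromTo-Σ {m} a b u = filteredSum-Σ _ (λ i → i) (suc (suc m)) (Vec.toList u)

+suc-1 : ∀ b → + suc b - + 1 ≡ + b
+suc-1 b = trans (cong (_- + 1) (ℤP.pos-+ 1 b)) (cancel (+ b))
  where
  cancel : ∀ x → + 1 + x - + 1 ≡ x
  cancel = solve-∀

≤pred⇔< : ∀ i b → (+ i ℤ.≤ + b - + 1 → i < b) × (i < b → + i ℤ.≤ + b - + 1)
≤pred⇔< i zero = (λ ()) , (λ ())
≤pred⇔< i (suc b) = (λ h → s≤s (ℤP.drop‿+≤+ (subst (+ i ℤ.≤_) (+suc-1 b) h)))
                   , (λ { (s≤s h) → subst (+ i ℤ.≤_) (sym (+suc-1 b)) (ℤ.+≤+ h) })

sel-interval : ∀ a b i x → a ≤ b →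
  sel ((+ a ℤ.≤? + i) ×-dec (+ i ℤ.≤? + b - + 1)) x ≡ sel (i ℕ.<? b) x - sel (i ℕ.<? a) x
sel-interval a b i x a≤b =
  trans (sel-iff (λ (p , q) → ℤP.drop‿+≤+ p , proj₁ (≤pred⇔< i b) q)
                 (λ (p , q) → ℤ.+≤+ p , proj₂ (≤pred⇔< i b) q) _ ((a ℕ.≤? i) ×-dec (i ℕ.<? b)) x)
        (split (a ℕ.≤? i) (i ℕ.<? b) (i ℕ.<? a))
  where
  split : (d₁ : Dec (a ≤ i)) (d₂ : Dec (i < b)) (d₃ : Dec (i < a)) → sel (d₁ ×-dec d₂) x ≡ sel d₂ x - sel d₃ x
  split (yes a≤i) _ (yes i<a) = ⊥-elim (ℕP.<-irrefl refl (ℕP.<-≤-trans i<a a≤i))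
  split (yes _) (yes _) (no _) = sym (ℤP.+-identityʳ x)
  split (yes _) (no _) (no _) = refl
  split (no a≰i) _ (no i≮a) = ⊥-elim (a≰i (ℕP.≮⇒≥ i≮a))
  split (no _) (yes _) (yes _) = sym (ℤP.+-inverseʳ x)
  split (no _) (no i≮b) (yes i<a) = ⊥-elim (i≮b (ℕP.<-≤-trans i<a a≤b))

Σℤ-truncate : ∀ F b N → b ≤ N → Σℤ (λ i → sel (i ℕ.<? b) (F i)) N ≡ Σℤ F b
Σℤ-truncate F b N b≤N = trans (cong (Σℤ _) (sym (ℕP.m+[n∸m]≡n b≤N))) (go (N ∸ b))
  where
  kept : ∀ i → i < b → (d : Dec (i < b)) → sel d (F i) ≡ F i
  kept i i<b (yes _) = refl
  kept i i<b (no i≮b) = ⊥-elim (i≮b i<b)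
  dropped : ∀ d (dec : Dec (b ℕ.+ d < b)) → sel dec (F (b ℕ.+ d)) ≡ + 0
  dropped d (yes lt) = ⊥-elim (ℕP.<-irrefl refl (ℕP.<-≤-trans lt (ℕP.m≤m+n b d)))
  dropped d (no _) = refl
  go : ∀ d → Σℤ (λ i → sel (i ℕ.<? b) (F i)) (b ℕ.+ d) ≡ Σℤ F b
  go zero = trans (cong (Σℤ _) (ℕP.+-identityʳ b)) (Σℤ-cong b (λ i i<b → kept i i<b (i ℕ.<? b)))
  go (suc d) = trans (cong (Σℤ _) (ℕP.+-suc b d))
                     (trans (cong₂ _+_ (go d) (dropped d (b ℕ.+ d ℕ.<? b))) (ℤP.+-identityʳ _))

sumFromTo-interval : ∀ {m} a b (u : Tuple m) → a ≤ b → b ≤ suc (suc m) →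
  sumFromTo (+ a) (+ b - + 1) u ≡ T u b - T u a
sumFromTo-interval {m} a b u a≤b b≤N = begin
    sumFromTo (+ a) (+ b - + 1) u
  ≡⟨ sumFromTo-Σ (+ a) (+ b - + 1) u ⟩
    Σℤ (λ i → sel ((+ a ℤ.≤? + i) ×-dec (+ i ℤ.≤? + b - + 1)) (co u i)) N
  ≡⟨ Σℤ-cong N (λ i _ → sel-interval a b i (co u i) a≤b) ⟩
    Σℤ (λ i → sel (i ℕ.<? b) (co u i) - sel (i ℕ.<? a) (co u i)) N
  ≡⟨ Σℤ-+ _ _ N ⟩
    Σℤ (λ i → sel (i ℕ.<? b) (co u i)) N + Σℤ (λ i → - sel (i ℕ.<? a) (co u i)) N
  ≡⟨ cong₂ _+_ (Σℤ-truncate (co u) b N b≤N)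
               (trans (Σℤ-neg _ N) (cong -_ (Σℤ-truncate (co u) a N (ℕP.≤-trans a≤b b≤N)))) ⟩
    T u b - T u a ∎
  where
  open ≡-Reasoning
  N = suc (suc m)

sumFromTo-prefix : ∀ {m} q (u : Tuple m) → q ≤ suc (suc m) → sumFromTo (+ 0) (+ q - + 1) u ≡ T u q
sumFromTo-prefix q u q≤N = trans (sumFromTo-interval 0 q u z≤n q≤N) (ℤP.+-identityʳ _)

sumFromTo-total : ∀ {m} (u : Tuple m) → sumFromTo (+ 0) (+ suc m) u ≡ T u (suc (suc m))
sumFromTo-total {m} u =
  trans (cong (λ z → sumFromTo (+ 0) z u) (sym (+suc-1 (suc m)))) (sumFromTo-prefix (suc (suc m)) u ℕP.≤-refl)

∣ℤ⇒multiple : ∀ {n} x → n ∣ℤ x → ∃ λ k → x ≡ k * + n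
∣ℤ⇒multiple {n} (+ a) (ℕD.divides q eq) = + q , trans (cong +_ eq) (ℤP.pos-* q n)
∣ℤ⇒multiple {n} -[1+ a ] (ℕD.divides q eq) =
  - + q , trans (cong -_ (trans (cong +_ eq) (ℤP.pos-* q n))) (ℤP.neg-distribˡ-* (+ q) (+ n))

multiple⇒∣ℤ : ∀ {n} x k → x ≡ k * + n → n ∣ℤ x
multiple⇒∣ℤ {n} x k eq = ℕD.divides ∣ k ∣ (trans (cong ∣_∣ eq) (ℤP.abs-* k (+ n)))

small-multiple : ∀ {n} x k → x ≡ k * + n → ∣ x ∣ < n → x ≡ + 0
small-multiple {n} x k eq lt = go ∣ k ∣ (trans (cong ∣_∣ eq) (ℤP.abs-* k (+ n)))
  where
  go : ∀ j → ∣ x ∣ ≡ j ℕ.* n → x ≡ + 0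
  go zero e = ℤP.∣i∣≡0⇒i≡0 e
  go (suc j) e = ⊥-elim (ℕP.<⇒≱ lt (ℕP.≤-trans (ℕP.m≤m+n n (j ℕ.* n)) (ℕP.≤-reflexive (sym e))))

%ℕ-shift : ∀ n .{{_ : NonZero n}} x → ∃ λ q → + (x %ℕ n) ≡ x + q * + n
%ℕ-shift n x = - (x /ℕ n) , trans (sym (cancel (+ (x %ℕ n)) (x /ℕ n) (+ n)))
                                  (cong (λ z → z + - (x /ℕ n) * + n) (sym (ℤDM.a≡a%ℕn+[a/ℕn]*n x n)))
  where
  cancel : ∀ a b c → a + b * c + - b * c ≡ a
  cancel = solve-∀

%ℕ-unique : ∀ n .{{_ : NonZero n}} x y k → + 0 ℤ.≤ y → y ℤ.< + n → y ≡ x + k * + n → + (x %ℕ n) ≡ y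
%ℕ-unique n x (+ y) k _ y<n y≡ with %ℕ-shift n x
... | q , r≡ = cong +_ (ℤP.+-injective (ℤP.i-j≡0⇒i≡j (+ r) (+ y) (small-multiple _ (q - k) diff bound)))
  where
  r = x %ℕ n
  rearrange : ∀ x q k n → x + q * n - (x + k * n) ≡ (q - k) * n
  rearrange = solve-∀
  diff : + r - + y ≡ (q - k) * + n
  diff = trans (cong₂ _-_ r≡ y≡) (rearrange x q k (+ n))
  bound : ∣ + r - + y ∣ < n
  bound = ℕP.≤-<-trans (subst (λ z → ∣ z ∣ ≤ r ℕ.⊔ y) (sym (ℤP.m-n≡m⊖n r y)) (ℤP.∣m⊝n∣≤m⊔n r y))
                       (ℕP.⊔-lub (ℤDM.n%ℕd<d x n) (ℤP.drop‿+<+ y<n))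

Trit : ℤ → Set
Trit x = x ≡ ℤ.-1ℤ ⊎ x ≡ + 0 ⊎ x ≡ + 1

Trit-abs : ∀ x → Trit x → ∣ x ∣ ≤ 1
Trit-abs _ (inj₁ refl) = ℕP.≤-refl
Trit-abs _ (inj₂ (inj₁ refl)) = z≤n
Trit-abs _ (inj₂ (inj₂ refl)) = ℕP.≤-refl

module Vertex {n m : ℕ} (v : Tuple m) (isV : IsVertex n m v) where

  first-range : + 0 ℤ.≤ co v 0 × co v 0 ℤ.< + n
  first-range = subst (λ z → + 0 ℤ.≤ z × z ℤ.< + n) (sym (at-lookup v Fin.zero)) (proj₁ isV Fin.zero (inj₁ refl))

  last-range : + 0 ℤ.≤ co v (suc m) × co v (suc m) ℤ.< + n
  last-range = subst (λ z → + 0 ℤ.≤ z × z ℤ.< + n) (co-lookup v (suc m) ℕP.≤-refl)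
                     (proj₁ isV _ (inj₂ (FinP.toℕ-fromℕ< (ℕP.≤-refl {suc (suc m)}))))

  middle-trit : ∀ i → 1 ≤ i → i ≤ m → Trit (co v i)
  middle-trit i 1≤i i≤m = subst Trit (co-lookup v i i<) (proj₁ (proj₂ isV) _ not-end)
    where
    i< : i < suc (suc m)
    i< = s≤s (ℕP.m≤n⇒m≤1+n i≤m)
    not-end : ¬ IsEnd m (Fin.fromℕ< i<)
    not-end (inj₁ e) = ℕP.<⇒≢ 1≤i (sym (trans (sym (FinP.toℕ-fromℕ< i<)) e))
    not-end (inj₂ e) = ℕP.<⇒≢ (s≤s i≤m) (trans (sym (FinP.toℕ-fromℕ< i<)) e)

  total-divisible : n ∣ℤ T v (suc (suc m))
  total-divisible = subst (n ∣ℤ_) (sumFromTo-total v) (proj₂ (proj₂ isV))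

  drift : ∀ a d → 1 ≤ a → a ℕ.+ d ≤ suc m → ∣ T v (a ℕ.+ d) - T v a ∣ ≤ d
  drift a zero 1≤a _ = ℕP.≤-reflexive (trans (cong (λ w → ∣ T v w - T v a ∣) (ℕP.+-identityʳ a)) (cong ∣_∣ (ℤP.+-inverseʳ (T v a))))
  drift a (suc d) 1≤a a+d<m+1 = begin
      ∣ T v (a ℕ.+ suc d) - T v a ∣             ≡⟨ cong ∣_∣ (trans (cong (λ w → T v w - T v a) (ℕP.+-suc a d)) (regroup (T v (a ℕ.+ d)) (co v (a ℕ.+ d)) (T v a))) ⟩
      ∣ T v (a ℕ.+ d) - T v a + co v (a ℕ.+ d) ∣ ≤⟨ ℤP.∣i+j∣≤∣i∣+∣j∣ (T v (a ℕ.+ d) - T v a) (co v (a ℕ.+ d)) ⟩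
      ∣ T v (a ℕ.+ d) - T v a ∣ ℕ.+ ∣ co v (a ℕ.+ d) ∣
          ≤⟨ ℕP.+-mono-≤ (drift a d 1≤a (ℕP.<⇒≤ a+d<m+1′))
                         (Trit-abs _ (middle-trit (a ℕ.+ d) (ℕP.≤-trans 1≤a (ℕP.m≤m+n a d)) (ℕP.≤-pred a+d<m+1′))) ⟩
      d ℕ.+ 1                                   ≡⟨ ℕP.+-comm d 1 ⟩
      suc d                                     ∎
    where
    open ℕP.≤-Reasoning
    a+d<m+1′ : a ℕ.+ d < suc m
    a+d<m+1′ = subst (_≤ suc m) (ℕP.+-suc a d) a+d<m+1
    regroup : ∀ t x a → t + x - a ≡ t - a + x
    regroup = solve-∀

-- A single edge changes the partial sums by a common multiple
-- of n plus a unit at one position, so d(u, 0) ≥ min_j C(u, j).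
C : (n m : ℕ) → Tuple m → ℤ → ℕ
C n m u j = Σℕ (λ p → ∣ T u (suc p) - j * + n ∣) (suc m)

C-zeroV : ∀ n m → C n m (zeroV m) (+ 0) ≡ 0
C-zeroV n m = Σℕ-zero _ (suc m) (λ p → cong ∣_∣ (trans (cong (λ z → z - + 0 * + n) (T-zeroV m (suc p))) (cancel (+ n))))
  where
  cancel : ∀ x → + 0 - + 0 * x ≡ + 0
  cancel = solve-∀

bump : ℕ → ℤ → ℕ → ℤ
bump i δ p with p ℕ.≟ i
... | yes _ = δ
... | no _ = + 0

bump-at : ∀ i δ p → p ≡ i → bump i δ p ≡ δ
bump-at i δ p e with p ℕ.≟ i
... | yes _ = refl
... | no ne = ⊥-elim (ne e)

bump-away : ∀ i δ p → ¬ p ≡ i → bump i δ p ≡ + 0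
bump-away i δ p ne with p ℕ.≟ i
... | yes e = ⊥-elim (ne e)
... | no _ = refl

bump-abs : ∀ i δ p → (δ ≡ + 1 ⊎ δ ≡ ℤ.-1ℤ) → ∣ bump i δ p ∣ ≤ ind i p
bump-abs i δ p unit with p ℕ.≟ i | unit
... | no _ | _ = z≤n
... | yes _ | inj₁ refl = ℕP.≤-refl
... | yes _ | inj₂ refl = ℕP.≤-refl

EdgeAt : (n m : ℕ) → Tuple m → Tuple m → ℕ → ℤ → Set
EdgeAt n m u v i δ =
  ∀ j → (¬ (toℕ j ≡ i) → ¬ (toℕ j ≡ suc i) → lookup u j ≡ lookup v j) ×
        (toℕ j ≡ i → CoordEq n m j (lookup u j) (lookup v j + δ)) ×
        (toℕ j ≡ suc i → CoordEq n m j (lookup u j) (lookup v j - δ))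

module Edge {n m : ℕ} (u v : Tuple m) (i : ℕ) (δ : ℤ) (edge : EdgeAt n m u v i δ) where

  middle-change : ∀ p → suc p ≤ m → co u (suc p) ≡ co v (suc p) + bump i δ (suc p) - bump i δ p
  middle-change p p<m = begin
      co u (suc p)                                   ≡⟨ co-lookup u (suc p) r< ⟨
      lookup u r                                     ≡⟨ cases (suc p ℕ.≟ i) (p ℕ.≟ i) ⟩
      lookup v r + (bump i δ (suc p) - bump i δ p)   ≡⟨ cong (_+ (bump i δ (suc p) - bump i δ p)) (co-lookup v (suc p) r<) ⟩
      co v (suc p) + (bump i δ (suc p) - bump i δ p) ≡⟨ ℤP.+-assoc (co v (suc p)) _ _ ⟨
      co v (suc p) + bump i δ (suc p) - bump i δ p   ∎
    where
    open ≡-Reasoning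
    r< = s≤s (ℕP.m≤n⇒m≤1+n p<m)
    r = Fin.fromℕ< r<
    index = FinP.toℕ-fromℕ< r<
    not-end : ¬ IsEnd m r
    not-end (inj₁ e) = ℕP.1+n≢0 (trans (sym index) e)
    not-end (inj₂ e) = ℕP.<⇒≢ (s≤s p<m) (trans (sym index) e)
    shift : ∀ d → lookup u r ≡ lookup v r + d → ∀ d′ → d ≡ d′ → lookup u r ≡ lookup v r + d′
    shift d e d′ refl = e
    cases : Dec (suc p ≡ i) → Dec (p ≡ i) → lookup u r ≡ lookup v r + (bump i δ (suc p) - bump i δ p)
    cases (yes e₁) (yes e₂) = ⊥-elim (ℕP.<⇒≢ (ℕP.n<1+n p) (trans e₂ (sym e₁)))
    cases (yes e₁) (no ne₂) = shift δ (proj₂ (proj₁ (proj₂ (edge r)) (trans index e₁)) not-end) _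
      (sym (trans (cong₂ _-_ (bump-at i δ (suc p) e₁) (bump-away i δ p ne₂)) (ℤP.+-identityʳ δ)))
    cases (no ne₁) (yes e₂) = shift (- δ) (proj₂ (proj₂ (proj₂ (edge r)) (trans index (cong suc e₂))) not-end) _
      (sym (trans (cong₂ _-_ (bump-away i δ (suc p) ne₁) (bump-at i δ p e₂)) (ℤP.+-identityˡ (- δ))))
    cases (no ne₁) (no ne₂) = shift (+ 0) (trans (proj₁ (edge r) (ne₁ ∘ trans (sym index)) (ne₂ ∘ ℕP.suc-injective ∘ trans (sym index)))
                                                (sym (ℤP.+-identityʳ (lookup v r))))
      _ (sym (cong₂ _-_ (bump-away i δ (suc p) ne₁) (bump-away i δ p ne₂)))

  first-change : ∃ λ a → co u 0 ≡ co v 0 + bump i δ 0 + a * + n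
  first-change with 0 ℕ.≟ i
  ... | yes e with ∣ℤ⇒multiple _ (proj₁ (proj₁ (proj₂ (edge Fin.zero)) e) (inj₁ refl))
  ...   | a , eq = a , trans (at-lookup u Fin.zero) (trans (add-back (lookup u Fin.zero) (lookup v Fin.zero) δ (a * + n) eq)
                             (cong (λ z → z + δ + a * + n) (sym (at-lookup v Fin.zero))))
    where
    add-back : ∀ x y d c → x - (y + d) ≡ c → x ≡ y + d + c
    add-back x y d c e = trans (sym (cancel x y d)) (cong (λ z → y + d + z) e)
      where
      cancel : ∀ x y d → y + d + (x - (y + d)) ≡ x
      cancel = solve-∀
  first-change | no ne = + 0 , trans (at-lookup u Fin.zero) (trans (proj₁ (edge Fin.zero) ne (λ ()))
                                (trans (sym (at-lookup v Fin.zero)) (sym (trans (ℤP.+-identityʳ _) (ℤP.+-identityʳ _)))))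

  a : ℤ
  a = proj₁ first-change

  prefix-change : ∀ p → p ≤ m → T u (suc p) ≡ T v (suc p) + a * + n + bump i δ p
  prefix-change zero _ =
    trans (ℤP.+-identityˡ _) (trans (proj₂ first-change) (reorder (co v 0) (bump i δ 0) (a * + n)))
    where
    reorder : ∀ x d c → x + d + c ≡ + 0 + x + c + d
    reorder = solve-∀
  prefix-change (suc p) p<m =
    trans (cong₂ _+_ (prefix-change p (ℕP.<⇒≤ p<m)) (middle-change p p<m))
          (telescope (T v (suc p)) (a * + n) (bump i δ p) (co v (suc p)) (bump i δ (suc p)))
    where
    telescope : ∀ t c d x d′ → t + c + d + (x + d′ - d) ≡ t + x + c + d′
    telescope = solve-∀

cost-step : ∀ {n m} (u v : Tuple m) → Adj n m u v → ∀ j → ∃ λ j′ → C n m u j′ ≤ suc (C n m v j)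
cost-step {n} {m} u v (i , δ , i≤m , unit , edge) j = j + a , bound
  where
  open Edge u v i δ edge
  termwise : ∀ p → p < suc m → ∣ T u (suc p) - (j + a) * + n ∣ ≤ ∣ T v (suc p) - j * + n ∣ ℕ.+ ind i p
  termwise p p≤m = begin
      ∣ T u (suc p) - (j + a) * + n ∣
    ≡⟨ cong ∣_∣ (trans (cong (λ z → z - (j + a) * + n) (prefix-change p (ℕP.≤-pred p≤m)))
                       (regroup (T v (suc p)) a (bump i δ p) j (+ n))) ⟩
      ∣ T v (suc p) - j * + n + bump i δ p ∣
    ≤⟨ ℤP.∣i+j∣≤∣i∣+∣j∣ (T v (suc p) - j * + n) (bump i δ p) ⟩
      ∣ T v (suc p) - j * + n ∣ ℕ.+ ∣ bump i δ p ∣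
    ≤⟨ ℕP.+-monoʳ-≤ _ (bump-abs i δ p unit) ⟩
      ∣ T v (suc p) - j * + n ∣ ℕ.+ ind i p ∎
    where
    open ℕP.≤-Reasoning
    regroup : ∀ t a d j n → t + a * n + d - (j + a) * n ≡ t - j * n + d
    regroup = solve-∀
  bound : C n m u (j + a) ≤ suc (C n m v j)
  bound = begin
      C n m u (j + a)                           ≤⟨ Σℕ-mono (suc m) termwise ⟩
      Σℕ (λ p → ∣ T v (suc p) - j * + n ∣ ℕ.+ ind i p) (suc m) ≡⟨ Σℕ-+ _ _ (suc m) ⟩
      C n m v j ℕ.+ Σℕ (ind i) (suc m)          ≤⟨ ℕP.+-monoʳ-≤ (C n m v j) (Σind≤1 i (suc m)) ⟩
      C n m v j ℕ.+ 1                           ≡⟨ ℕP.+-comm _ 1 ⟩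
      suc (C n m v j)                           ∎
    where open ℕP.≤-Reasoning

cost-lower : ∀ {n m u L} → Walk n m u (zeroV m) L → ∃ λ j → C n m u j ≤ L
cost-lower {n} {m} (here _) = + 0 , ℕP.≤-reflexive (C-zeroV n m)
cost-lower (step {u} {v} _ adj walk) with cost-lower walk
... | j , Cv≤ with cost-step u v adj j
... | j′ , Cu≤ = j′ , ℕP.≤-trans Cu≤ (s≤s Cv≤)

move : (ℕ → ℤ) → ℕ → ℤ → ℕ → ℤ
move s M δ p with p ℕ.≟ M
... | yes _ = s p - δ
... | no _ = s p

move-at : ∀ s M δ p → p ≡ M → move s M δ p ≡ s p - δ
move-at s M δ p e with p ℕ.≟ M
... | yes _ = refl
... | no ne = ⊥-elim (ne e)

move-away : ∀ s M δ p → ¬ p ≡ M → move s M δ p ≡ s p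
move-away s M δ p ne with p ℕ.≟ M
... | yes e = ⊥-elim (ne e)
... | no _ = refl

Trit-lower : ∀ x → Trit x → + 0 ℤ.≤ x → Trit (x - + 1)
Trit-lower _ (inj₁ refl) ()
Trit-lower _ (inj₂ (inj₁ refl)) _ = inj₁ refl
Trit-lower _ (inj₂ (inj₂ refl)) _ = inj₂ (inj₁ refl)

Trit-raise : ∀ x → Trit x → x ℤ.≤ + 0 → Trit (x + + 1)
Trit-raise _ (inj₁ refl) _ = inj₂ (inj₁ refl)
Trit-raise _ (inj₂ (inj₁ refl)) _ = inj₂ (inj₂ refl)
Trit-raise _ (inj₂ (inj₂ refl)) (ℤ.+≤+ ())

closer-down : ∀ x c → c ℤ.< x → ∣ x - c ∣ ≡ suc ∣ x - + 1 - c ∣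
closer-down x c c<x = cong ∣_∣ (trans (split x c) (cong (λ z → + 1 + z) (sym (ℤP.0≤i⇒+∣i∣≡i 0≤rest))))
  where
  split : ∀ x c → x - c ≡ + 1 + (x - + 1 - c)
  split = solve-∀
  regroup : ∀ x c → x - (+ 1 + c) ≡ x - + 1 - c
  regroup = solve-∀
  0≤rest : + 0 ℤ.≤ x - + 1 - c
  0≤rest = subst (+ 0 ℤ.≤_) (regroup x c) (ℤP.i≤j⇒0≤j-i (ℤP.i<j⇒suc[i]≤j c<x))

closer-up : ∀ x c → x ℤ.< c → ∣ x - c ∣ ≡ suc ∣ x - ℤ.-1ℤ - c ∣
closer-up x c x<c =
  trans (ℤP.∣i-j∣≡∣j-i∣ x c) (trans (closer-down c x x<c) (cong suc (trans (cong ∣_∣ (flip c x)) (ℤP.∣-i∣≡∣i∣ (x - ℤ.-1ℤ - c)))))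
  where
  flip : ∀ c x → c - + 1 - x ≡ - (x - ℤ.-1ℤ - c)
  flip = solve-∀

Σℕ-drop : ∀ F F′ N M → M < N → (∀ p → ¬ p ≡ M → F p ≡ F′ p) → F M ≡ suc (F′ M) → Σℕ F N ≡ suc (Σℕ F′ N)
Σℕ-drop F F′ (suc N) M M<N same drop with N ℕ.≟ M
... | yes refl = trans (cong₂ ℕ._+_ (Σℕ-cong N (λ i i<N → same i (ℕP.<⇒≢ i<N))) drop) (ℕP.+-suc _ _)
... | no ne = cong₂ ℕ._+_ (Σℕ-drop F F′ N M (ℕP.≤∧≢⇒< (ℕP.≤-pred M<N) (ne ∘ sym)) same drop) (same N ne)

argmax : ∀ (s : ℕ → ℤ) N → ∃ λ M → M ≤ N × (∀ p → p ≤ N → s p ℤ.≤ s M)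
argmax s zero = 0 , z≤n , λ { zero _ → ℤP.≤-refl }
argmax s (suc N) with argmax s N
... | M , M≤N , max with s M ℤ.≤? s (suc N)
... | yes le = suc N , ℕP.≤-refl , bounded
  where
  bounded : ∀ p → p ≤ suc N → s p ℤ.≤ s (suc N)
  bounded p p≤ with ℕP.m≤n⇒m<n∨m≡n p≤
  ... | inj₁ p< = ℤP.≤-trans (max p (ℕP.≤-pred p<)) le
  ... | inj₂ refl = ℤP.≤-refl
... | no ≰ = M , ℕP.m≤n⇒m≤1+n M≤N , bounded
  where
  bounded : ∀ p → p ≤ suc N → s p ℤ.≤ s M
  bounded p p≤ with ℕP.m≤n⇒m<n∨m≡n p≤
  ... | inj₁ p< = max p (ℕP.≤-pred p<)
  ... | inj₂ refl = ℤP.<⇒≤ (ℤP.≰⇒> ≰)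

argmin : ∀ (s : ℕ → ℤ) N → ∃ λ M → M ≤ N × (∀ p → p ≤ N → s M ℤ.≤ s p)
argmin s N with argmax (λ p → - s p) N
... | M , M≤N , max = M , M≤N , λ p p≤N → ℤP.neg-cancel-≤ (max p p≤N)

-- A profile s encodes the tuple with coordinates u_0 = s_0 mod n, u_{r+1} = s_{r+1} − s_r
-- (r < m) and u_{m+1} = −s_m mod n; its partial sums are s_0, …, s_m up to a multiple of n.
module Profile (n m : ℕ) .{{_ : NonZero n}} where

  coord : (ℕ → ℤ) → ℕ → ℤ
  coord s zero = + (s 0 %ℕ n)
  coord s (suc r) with r ℕ.≟ m
  ... | yes _ = + ((- s m) %ℕ n)
  ... | no _ = s (suc r) - s r

  coord-last : ∀ s → coord s (suc m) ≡ + ((- s m) %ℕ n)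
  coord-last s with m ℕ.≟ m
  ... | yes _ = refl
  ... | no ne = ⊥-elim (ne refl)

  coord-middle : ∀ s r → ¬ r ≡ m → coord s (suc r) ≡ s (suc r) - s r
  coord-middle s r ne with r ℕ.≟ m
  ... | yes e = ⊥-elim (ne e)
  ... | no _ = refl

  tuple : (ℕ → ℤ) → Tuple m
  tuple s = tabulate (λ j → coord s (toℕ j))

  lookup-tuple : ∀ s j → lookup (tuple s) j ≡ coord s (toℕ j)
  lookup-tuple s j = VecP.lookup∘tabulate (λ k → coord s (toℕ k)) j

  co-tuple : ∀ s r → r < suc (suc m) → co (tuple s) r ≡ coord s r
  co-tuple s r r< = trans (co-tabulate (λ j → coord s (toℕ j)) r r<) (cong (coord s) (FinP.toℕ-fromℕ< r<))

  UnitSteps : (ℕ → ℤ) → Set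
  UnitSteps s = ∀ p → p < m → Trit (s (suc p) - s p)

  Φ : ℤ → (ℕ → ℤ) → ℕ
  Φ c s = Σℕ (λ p → ∣ s p - c ∣) (suc m)

  tuple-prefix : ∀ s q → q ≤ m → T (tuple s) (suc q) ≡ coord s 0 + s q - s 0
  tuple-prefix s zero _ = trans (ℤP.+-identityˡ _) (trans (co-tuple s 0 (s≤s z≤n)) (sym (cancel (coord s 0) (s 0))))
    where
    cancel : ∀ a b → a + b - b ≡ a
    cancel = solve-∀
  tuple-prefix s (suc q) q<m = trans (cong₂ _+_ (tuple-prefix s q (ℕP.<⇒≤ q<m)) last-step)
                                    (telescope (coord s 0) (s q) (s 0) (s (suc q)))
    where
    last-step : co (tuple s) (suc q) ≡ s (suc q) - s q
    last-step = trans (co-tuple s (suc q) (s≤s (ℕP.m≤n⇒m≤1+n q<m))) (coord-middle s q (ℕP.<⇒≢ q<m))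
    telescope : ∀ e a b c → e + a - b + (c - a) ≡ e + c - b
    telescope = solve-∀

  tuple-isVertex : ∀ s → UnitSteps s → IsVertex n m (tuple s)
  tuple-isVertex s steps = ends , middles , divisible
    where
    ends : ∀ j → IsEnd m j → (+ 0 ℤ.≤ lookup (tuple s) j) × (lookup (tuple s) j ℤ.< + n)
    ends j (inj₁ e) rewrite lookup-tuple s j | e = ℤ.+≤+ z≤n , ℤ.+<+ (ℤDM.n%ℕd<d (s 0) n)
    ends j (inj₂ e) rewrite lookup-tuple s j | e | coord-last s = ℤ.+≤+ z≤n , ℤ.+<+ (ℤDM.n%ℕd<d (- s m) n)
    middles : ∀ j → ¬ IsEnd m j → Trit (lookup (tuple s) j)
    middles j ne rewrite lookup-tuple s j = go (toℕ j) (FinP.toℕ≤pred[n] j) (ne ∘ inj₁) (ne ∘ inj₂)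
      where
      go : ∀ r → r ≤ suc m → ¬ r ≡ 0 → ¬ r ≡ suc m → Trit (coord s r)
      go zero _ r≢0 _ = ⊥-elim (r≢0 refl)
      go (suc q) r≤ _ r≢ = subst Trit (sym (coord-middle s q (r≢ ∘ cong suc)))
                                 (steps q (ℕP.≤∧≢⇒< (ℕP.≤-pred r≤) (r≢ ∘ cong suc)))
    divisible : n ∣ℤ sumFromTo (+ 0) (+ suc m) (tuple s)
    divisible = subst (n ∣ℤ_) (sym (sumFromTo-total (tuple s)))
                      (multiple⇒∣ℤ _ (q₁ + q₂) (trans (cong₂ _+_ (tuple-prefix s m ℕP.≤-refl) last)
                        (trans (cong₂ (λ a b → a + s m - s 0 + b) r₁ r₂) (collect (s 0) (s m) q₁ q₂ (+ n)))))
      where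
      q₁ = proj₁ (%ℕ-shift n (s 0))
      r₁ = proj₂ (%ℕ-shift n (s 0))
      q₂ = proj₁ (%ℕ-shift n (- s m))
      r₂ = proj₂ (%ℕ-shift n (- s m))
      last : co (tuple s) (suc m) ≡ + ((- s m) %ℕ n)
      last = trans (co-tuple s (suc m) ℕP.≤-refl) (coord-last s)
      collect : ∀ a b q₁ q₂ n → a + q₁ * n + b - a + (- b + q₂ * n) ≡ (q₁ + q₂) * n
      collect = solve-∀

  CoordEqAt : ℕ → ℤ → ℤ → Set
  CoordEqAt r a b = ((r ≡ 0 ⊎ r ≡ suc m) → n ∣ℤ (a - b)) × (¬ (r ≡ 0 ⊎ r ≡ suc m) → a ≡ b)

  module Move (s : ℕ → ℤ) (M : ℕ) (δ : ℤ) (M≤m : M ≤ m) where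
    s′ = move s M δ

    far : ∀ r → ¬ r ≡ M → ¬ r ≡ suc M → coord s r ≡ coord s′ r
    far zero ne₁ _ = cong (λ z → + (z %ℕ n)) (sym (move-away s M δ 0 ne₁))
    far (suc q) ne₁ ne₂ with q ℕ.≟ m
    ... | yes refl = cong (λ z → + ((- z) %ℕ n)) (sym (move-away s M δ m (ne₂ ∘ cong suc)))
    ... | no _ = cong₂ _-_ (sym (move-away s M δ (suc q) ne₁)) (sym (move-away s M δ q (ne₂ ∘ cong suc)))

    at-M : ∀ r → r ≡ M → CoordEqAt r (coord s r) (coord s′ r + δ)
    at-M zero e = (λ _ → multiple⇒∣ℤ _ (q₁ - q₂)
                    (trans (cong₂ (λ a b → a - (b + δ)) r₁ (trans (cong (λ z → + (z %ℕ n)) (move-at s M δ 0 e)) r₂))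
                           (collect (s 0) δ q₁ q₂ (+ n))))
                , (λ ne → ⊥-elim (ne (inj₁ refl)))
      where
      q₁ = proj₁ (%ℕ-shift n (s 0))
      r₁ = proj₂ (%ℕ-shift n (s 0))
      q₂ = proj₁ (%ℕ-shift n (s 0 - δ))
      r₂ = proj₂ (%ℕ-shift n (s 0 - δ))
      collect : ∀ a d q₁ q₂ n → a + q₁ * n - (a - d + q₂ * n + d) ≡ (q₁ - q₂) * n
      collect = solve-∀
    at-M (suc q) e = (λ { (inj₁ ()) ; (inj₂ e′) → ⊥-elim (q≢m (ℕP.suc-injective e′)) })
                   , (λ _ → trans (coord-middle s q q≢m) (sym (trans (cong (_+ δ) moved) (cancel (s (suc q)) δ (s q)))))
      where
      q≢m : ¬ q ≡ m
      q≢m = ℕP.<⇒≢ (subst (_≤ m) (sym e) M≤m)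
      moved : coord s′ (suc q) ≡ s (suc q) - δ - s q
      moved = trans (coord-middle s′ q q≢m)
                    (cong₂ _-_ (move-at s M δ (suc q) e) (move-away s M δ q (λ e′ → ℕP.<⇒≢ (ℕP.n<1+n q) (trans e′ (sym e)))))
      cancel : ∀ a d b → a - d - b + d ≡ a - b
      cancel = solve-∀

    after-M : ∀ r → r ≡ suc M → CoordEqAt r (coord s r) (coord s′ r - δ)
    after-M zero ()
    after-M (suc q) e with q ℕ.≟ m
    ... | yes refl = (λ _ → multiple⇒∣ℤ _ (q₁ - q₂)
                        (trans (cong₂ (λ a b → a - (b - δ)) r₁
                                      (trans (cong (λ z → + ((- z) %ℕ n)) (move-at s M δ m (ℕP.suc-injective e))) r₂))
                               (collect (s m) δ q₁ q₂ (+ n))))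
                   , (λ ne → ⊥-elim (ne (inj₂ refl)))
      where
      q₁ = proj₁ (%ℕ-shift n (- s m))
      r₁ = proj₂ (%ℕ-shift n (- s m))
      q₂ = proj₁ (%ℕ-shift n (- (s m - δ)))
      r₂ = proj₂ (%ℕ-shift n (- (s m - δ)))
      collect : ∀ a d q₁ q₂ n → - a + q₁ * n - (- (a - d) + q₂ * n - d) ≡ (q₁ - q₂) * n
      collect = solve-∀
    ... | no q≢m = (λ { (inj₁ ()) ; (inj₂ e′) → ⊥-elim (q≢m (ℕP.suc-injective e′)) })
                 , (λ _ → sym (trans (cong (_- δ) moved) (cancel (s (suc q)) (s q) δ)))
      where
      q≡M = ℕP.suc-injective e
      moved : s′ (suc q) - s′ q ≡ s (suc q) - (s q - δ)
      moved = cong₂ _-_ (move-away s M δ (suc q) (λ e′ → ℕP.<⇒≢ (ℕP.n<1+n q) (trans q≡M (sym e′))))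
                        (move-at s M δ q q≡M)
      cancel : ∀ a b d → a - (b - d) - d ≡ a - b
      cancel = solve-∀

    edge : (δ ≡ + 1 ⊎ δ ≡ ℤ.-1ℤ) → Adj n m (tuple s) (tuple s′)
    edge unit = M , δ , M≤m , unit , λ j → c₁ j , c₂ j , c₃ j
      where
      c₁ : ∀ j → ¬ toℕ j ≡ M → ¬ toℕ j ≡ suc M → lookup (tuple s) j ≡ lookup (tuple s′) j
      c₁ j ne₁ ne₂ rewrite lookup-tuple s j | lookup-tuple s′ j = far (toℕ j) ne₁ ne₂
      c₂ : ∀ j → toℕ j ≡ M → CoordEq n m j (lookup (tuple s) j) (lookup (tuple s′) j + δ)
      c₂ j e rewrite lookup-tuple s j | lookup-tuple s′ j = at-M (toℕ j) e
      c₃ : ∀ j → toℕ j ≡ suc M → CoordEq n m j (lookup (tuple s) j) (lookup (tuple s′) j - δ)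
      c₃ j e rewrite lookup-tuple s j | lookup-tuple s′ j = after-M (toℕ j) e

    unit-steps : UnitSteps s → (∀ p → p < m → suc p ≡ M → Trit (s (suc p) - s p - δ)) →
                 (∀ p → p < m → p ≡ M → Trit (s (suc p) - s p + δ)) → UnitSteps s′
    unit-steps steps into out p p<m = cases (suc p ℕ.≟ M) (p ℕ.≟ M)
      where
      cases : Dec (suc p ≡ M) → Dec (p ≡ M) → Trit (s′ (suc p) - s′ p)
      cases (yes e₁) (yes e₂) = ⊥-elim (ℕP.<⇒≢ (ℕP.n<1+n p) (trans e₂ (sym e₁)))
      cases (yes e₁) (no ne₂) = subst Trit (sym (trans (cong₂ _-_ (move-at s M δ (suc p) e₁) (move-away s M δ p ne₂))
                                                       (swap (s (suc p)) δ (s p)))) (into p p<m e₁)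
        where
        swap : ∀ a d b → a - d - b ≡ a - b - d
        swap = solve-∀
      cases (no ne₁) (yes e₂) = subst Trit (sym (trans (cong₂ _-_ (move-away s M δ (suc p) ne₁) (move-at s M δ p e₂))
                                                       (swap (s (suc p)) δ (s p)))) (out p p<m e₂)
        where
        swap : ∀ a d b → a - (b - d) ≡ a - b + d
        swap = solve-∀
      cases (no ne₁) (no ne₂) = subst Trit (sym (cong₂ _-_ (move-away s M δ (suc p) ne₁) (move-away s M δ p ne₂)))
                                      (steps p p<m)

  Closer : ℤ → (ℕ → ℤ) → Set
  Closer c s = ∃ λ s′ → UnitSteps s′ × (Φ c s ≡ suc (Φ c s′)) × Adj n m (tuple s) (tuple s′)

  lower-max : ∀ c s → UnitSteps s → ∀ M → M ≤ m → (∀ p → p ≤ m → s p ℤ.≤ s M) → c ℤ.< s M → Closer c s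
  lower-max c s steps M M≤m max c<sM =
    s′ , unit-steps steps into out , Σℕ-drop _ _ (suc m) M (s≤s M≤m) same closer , edge (inj₁ refl)
    where
    open Move s M (+ 1) M≤m
    into : ∀ p → p < m → suc p ≡ M → Trit (s (suc p) - s p - + 1)
    into p p<m e = Trit-lower _ (steps p p<m) (ℤP.i≤j⇒0≤j-i (subst (λ z → s p ℤ.≤ s z) (sym e) (max p (ℕP.<⇒≤ p<m))))
    out : ∀ p → p < m → p ≡ M → Trit (s (suc p) - s p + + 1)
    out p p<m e = Trit-raise _ (steps p p<m) (ℤP.i≤j⇒i-j≤0 (subst (λ z → s (suc p) ℤ.≤ s z) (sym e) (max (suc p) p<m)))
    same : ∀ p → ¬ p ≡ M → ∣ s p - c ∣ ≡ ∣ s′ p - c ∣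
    same p ne = cong (λ z → ∣ z - c ∣) (sym (move-away s M (+ 1) p ne))
    closer : ∣ s M - c ∣ ≡ suc ∣ s′ M - c ∣
    closer = trans (closer-down (s M) c c<sM) (cong (λ z → suc ∣ z - c ∣) (sym (move-at s M (+ 1) M refl)))

  raise-min : ∀ c s → UnitSteps s → ∀ N → N ≤ m → (∀ p → p ≤ m → s N ℤ.≤ s p) → s N ℤ.< c → Closer c s
  raise-min c s steps N N≤m min sN<c =
    s′ , unit-steps steps into out , Σℕ-drop _ _ (suc m) N (s≤s N≤m) same closer , edge (inj₂ refl)
    where
    open Move s N ℤ.-1ℤ N≤m
    into : ∀ p → p < m → suc p ≡ N → Trit (s (suc p) - s p - ℤ.-1ℤ)
    into p p<m e = Trit-raise _ (steps p p<m) (ℤP.i≤j⇒i-j≤0 (subst (λ z → s z ℤ.≤ s p) (sym e) (min p (ℕP.<⇒≤ p<m))))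
    out : ∀ p → p < m → p ≡ N → Trit (s (suc p) - s p + ℤ.-1ℤ)
    out p p<m e = Trit-lower _ (steps p p<m) (ℤP.i≤j⇒0≤j-i (subst (λ z → s z ℤ.≤ s (suc p)) (sym e) (min (suc p) p<m)))
    same : ∀ p → ¬ p ≡ N → ∣ s p - c ∣ ≡ ∣ s′ p - c ∣
    same p ne = cong (λ z → ∣ z - c ∣) (sym (move-away s N ℤ.-1ℤ p ne))
    closer : ∣ s N - c ∣ ≡ suc ∣ s′ N - c ∣
    closer = trans (closer-up (s N) c sN<c) (cong (λ z → suc ∣ z - c ∣) (sym (move-at s N ℤ.-1ℤ N refl)))

  flat-is-zero : ∀ j s → (∀ p → p ≤ m → s p ≡ j * + n) → tuple s ≡ zeroV m
  flat-is-zero j s flat =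
    trans (VecP.tabulate-cong (λ k → trans (zero-coord (toℕ k) (FinP.toℕ≤pred[n] k)) (sym (VecP.lookup-replicate k (+ 0)))))
          (VecP.tabulate∘lookup (zeroV m))
    where
    0<n : + 0 ℤ.< + n
    0<n = ℤ.+<+ (ℕ.>-nonZero⁻¹ n)
    cancel₁ : ∀ j n → j * n + - j * n ≡ + 0
    cancel₁ = solve-∀
    cancel₂ : ∀ j n → - (j * n) + j * n ≡ + 0
    cancel₂ = solve-∀
    zero-coord : ∀ r → r ≤ suc m → coord s r ≡ + 0
    zero-coord zero _ =
      %ℕ-unique n (s 0) (+ 0) (- j) ℤP.≤-refl 0<n (sym (trans (cong (λ z → z + - j * + n) (flat 0 z≤n)) (cancel₁ j (+ n))))
    zero-coord (suc q) r≤ with q ℕ.≟ m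
    ... | yes refl =
      %ℕ-unique n (- s m) (+ 0) j ℤP.≤-refl 0<n (sym (trans (cong (λ z → - z + j * + n) (flat m ℕP.≤-refl)) (cancel₂ j (+ n))))
    ... | no q≢m = trans (cong₂ _-_ (flat (suc q) q<m) (flat q (ℕP.<⇒≤ q<m))) (ℤP.+-inverseʳ (j * + n))
      where
      q<m = ℕP.≤∧≢⇒< (ℕP.≤-pred r≤) q≢m

  greedy-step : ∀ j s → UnitSteps s → Closer (j * + n) s ⊎ (tuple s ≡ zeroV m × Φ (j * + n) s ≡ 0)
  greedy-step j s steps with argmax s m | argmin s m
  ... | M , M≤m , max | N , N≤m , min with j * + n ℤ.<? s M | s N ℤ.<? j * + n
  ...   | yes c<sM | _ = inj₁ (lower-max (j * + n) s steps M M≤m max c<sM)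
  ...   | no _ | yes sN<c = inj₁ (raise-min (j * + n) s steps N N≤m min sN<c)
  ...   | no sM≤c | no c≤sN = inj₂ (flat-is-zero j s flat , Φ-zero)
    where
    c = j * + n
    flat : ∀ p → p ≤ m → s p ≡ c
    flat p p≤m = ℤP.≤-antisym (ℤP.≤-trans (max p p≤m) (ℤP.≮⇒≥ sM≤c)) (ℤP.≤-trans (ℤP.≮⇒≥ c≤sN) (min p p≤m))
    Φ-zero : Φ c s ≡ 0
    Φ-zero = trans (Σℕ-cong (suc m) (λ p p≤m → cong (λ z → ∣ z - c ∣) (flat p (ℕP.≤-pred p≤m))))
                   (Σℕ-zero _ (suc m) (λ _ → cong ∣_∣ (ℤP.+-inverseʳ c)))

  greedy-walk : ∀ j K s → UnitSteps s → Φ (j * + n) s ≡ K → Walk n m (tuple s) (zeroV m) K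
  greedy-walk j K s steps Φ≡K with greedy-step j s steps | K
  ... | inj₁ (s′ , steps′ , drop , edge) | zero = ⊥-elim (ℕP.1+n≢0 (trans (sym drop) Φ≡K))
  ... | inj₁ (s′ , steps′ , drop , edge) | suc K′ =
    step (tuple-isVertex s steps) edge (greedy-walk j K′ s′ steps′ (ℕP.suc-injective (trans (sym drop) Φ≡K)))
  ... | inj₂ (is-zero , Φ≡0) | zero =
    subst (λ t → Walk n m t (zeroV m) 0) (sym is-zero) (here (subst (IsVertex n m) is-zero (tuple-isVertex s steps)))
  ... | inj₂ (is-zero , Φ≡0) | suc K′ = ⊥-elim (ℕP.1+n≢0 (trans (sym Φ≡K) Φ≡0))

  -- upper bound: every vertex v is its own profile's tuple, with Φ_{jn} = C(v, j), so d(v, 0) ≤ C(v, j)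
  cost-upper : ∀ v → IsVertex n m v → ∀ j → DistLe n m v (zeroV m) (C n m v j)
  cost-upper v isV j =
    C n m v j , ℕP.≤-refl , subst (λ t → Walk n m t (zeroV m) (C n m v j)) encodes (greedy-walk j _ s steps refl)
    where
    open Vertex v isV
    s : ℕ → ℤ
    s p = T v (suc p)
    cancel : ∀ a b → a + b - a ≡ b
    cancel = solve-∀
    steps : UnitSteps s
    steps p p<m = subst Trit (sym (cancel (T v (suc p)) (co v (suc p)))) (middle-trit (suc p) (s≤s z≤n) p<m)
    same-coord : ∀ r → r < suc (suc m) → coord s r ≡ co v r
    same-coord zero _ = %ℕ-unique n (T v 1) (co v 0) (+ 0) (proj₁ first-range) (proj₂ first-range) (sym (drop0 (co v 0) (+ n)))
      where
      drop0 : ∀ a n → + 0 + a + + 0 * n ≡ a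
      drop0 = solve-∀
    same-coord (suc q) _ with q ℕ.≟ m
    ... | yes refl = %ℕ-unique n (- T v (suc m)) (co v (suc m)) k (proj₁ last-range) (proj₂ last-range)
                               (trans (sym (cancel′ (T v (suc m)) (co v (suc m)))) (cong (λ z → - T v (suc m) + z) k≡))
      where
      k = proj₁ (∣ℤ⇒multiple (T v (suc (suc m))) total-divisible)
      k≡ = proj₂ (∣ℤ⇒multiple (T v (suc (suc m))) total-divisible)
      cancel′ : ∀ t a → - t + (t + a) ≡ a
      cancel′ = solve-∀
    ... | no _ = cancel (T v (suc q)) (co v (suc q))
    encodes : tuple s ≡ v
    encodes = tabulate-co v (coord s) same-coord

foldr⊔-upper : ∀ b xs {y} → y ∈ xs → y ℤ.≤ List.foldr _⊔_ b xs
foldr⊔-upper b (x ∷ xs) (Any.here refl) = ℤP.i≤i⊔j x _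
foldr⊔-upper b (x ∷ xs) (Any.there y∈) = ℤP.i≤j⇒i≤k⊔j x (foldr⊔-upper b xs y∈)

foldr⊓-lower : ∀ b xs {y} → y ∈ xs → List.foldr _⊓_ b xs ℤ.≤ y
foldr⊓-lower b (x ∷ xs) (Any.here refl) = ℤP.i⊓j≤i x _
foldr⊓-lower b (x ∷ xs) (Any.there y∈) = ℤP.i≤j⇒k⊓i≤j x (foldr⊓-lower b xs y∈)

foldr⊓ℕ-lower : ∀ b (xs : List ℕ) {y} → y ∈ xs → List.foldr ℕ._⊓_ b xs ≤ y
foldr⊓ℕ-lower b (x ∷ xs) (Any.here refl) = ℕP.m⊓n≤m x _
foldr⊓ℕ-lower b (x ∷ xs) (Any.there y∈) = ℕP.m≤n⇒o⊓m≤n x (foldr⊓ℕ-lower b xs y∈)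

halve : ∀ a b → a ℕ.+ a ≤ b ℕ.+ b → a ≤ b
halve a b h with a ℕ.≤? b
... | yes a≤b = a≤b
... | no a≰b = ⊥-elim (ℕP.<⇒≱ (ℕP.+-mono-< (ℕP.≰⇒> a≰b) (ℕP.≰⇒> a≰b)) h)

pred-cancel : ∀ a b → + a - + 1 ℤ.≤ + b - + 1 → a ≤ b
pred-cancel a b h = ℤP.drop‿+≤+ (subst₂ ℤ._≤_ (cancel (+ a)) (cancel (+ b)) (ℤP.+-monoˡ-≤ (+ 1) h))
  where
  cancel : ∀ x → x - + 1 + + 1 ≡ x
  cancel = solve-∀

-- The candidate pivot p = q − 1 lies in the left half (2p < m) or in the right half
-- (2p ≥ m) of [−1, m+1]; on each side |2p − m| is a difference of natural numbers.
data Side (m q : ℕ) : Set where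
  left  : q ℕ.+ q < suc (suc m) → ∣ + 2 * (+ q - + 1) - + m ∣ ℕ.+ (q ℕ.+ q) ≡ suc (suc m) →
          + 2 * (+ q - + 1) ℤ.< + m → Side m q
  right : suc (suc m) ≤ q ℕ.+ q → ∣ + 2 * (+ q - + 1) - + m ∣ ℕ.+ suc (suc m) ≡ q ℕ.+ q →
          + m ℤ.≤ + 2 * (+ q - + 1) → Side m q

centred : ∀ m q → + 2 * (+ q - + 1) - + m ≡ (q ℕ.+ q) ⊖ suc (suc m)
centred m q = trans (regroup (+ q) (+ m)) (trans (cong₂ _-_ (sym (ℤP.pos-+ q q)) (sym (ℤP.pos-+ 2 m))) (ℤP.m-n≡m⊖n (q ℕ.+ q) (suc (suc m))))
  where
  regroup : ∀ q m → + 2 * (q - + 1) - m ≡ q + q - (+ 2 + m)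
  regroup = solve-∀

uncentred : ∀ m q → + 2 * (+ q - + 1) ≡ (q ℕ.+ q) ⊖ suc (suc m) + + m
uncentred m q = trans (sym (cancel (+ 2 * (+ q - + 1)) (+ m))) (cong (_+ + m) (centred m q))
  where
  cancel : ∀ x m → x - m + m ≡ x
  cancel = solve-∀

side : ∀ m q → Side m q
side m q with q ℕ.+ q ℕ.<? suc (suc m)
... | yes Q<M = left Q<M (trans (cong (ℕ._+ Q) (trans (cong ∣_∣ (trans (centred m q) (ℤP.⊖-< Q<M))) (ℤP.∣-i∣≡∣i∣ (+ (M ∸ Q)))))
                                (ℕP.m∸n+n≡m (ℕP.<⇒≤ Q<M)))
                     (subst (ℤ._< + m) (sym (uncentred m q)) (ℤP.+-monoˡ-< (+ m) negative))
  where
  Q = q ℕ.+ q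
  M = suc (suc m)
  negative : Q ⊖ M ℤ.< + 0
  negative = subst (ℤ._< + 0) (sym (ℤP.⊖-< Q<M)) (neg-suc (M ∸ Q) (ℕP.m<n⇒0<n∸m Q<M))
    where
    neg-suc : ∀ k → 0 < k → - + k ℤ.< + 0
    neg-suc (suc k) _ = ℤ.-<+
... | no Q≮M = right M≤Q (trans (cong (ℕ._+ M) (cong ∣_∣ (trans (centred m q) (ℤP.≤-⊖ M≤Q)))) (ℕP.m∸n+n≡m M≤Q))
                       (subst (+ m ℤ.≤_) (sym (trans (uncentred m q) (cong (_+ + m) (ℤP.≤-⊖ M≤Q))))
                              (ℤP.≤-trans (ℤP.i≤i+j (+ m) (+ (Q ∸ M))) (ℤP.≤-reflexive (ℤP.+-comm (+ m) (+ (Q ∸ M))))))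
  where
  Q = q ℕ.+ q
  M = suc (suc m)
  M≤Q = ℕP.≮⇒≥ Q≮M

-- A pivot p of v is p = q − 1 for a prefix length q ≤ m+2 with n ∣ T v q.
module Pivots {n m : ℕ} (v : Tuple m) (isV : IsVertex n m v) where
  open Vertex v isV

  opaque
    pivot-prefix : ∀ {x} → x ∈ Piv n v → ∃ λ q → q ≤ suc (suc m) × x ≡ + q - + 1 × n ∣ℤ T v q
    pivot-prefix {x} x∈ with ∈P.∈-filter⁻ (pivotCond? n v) x∈
    ... | candidate , n∣T with ∈P.∈-map⁻ (λ w → + w - + 1) candidate
    ... | q , q∈ , x≡ = q , q≤ , x≡ , subst (n ∣ℤ_) (trans (cong (λ w → sumFromTo (+ 0) w v) x≡) (sumFromTo-prefix q v q≤)) n∣T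
      where
      q≤ : q ≤ suc (suc m)
      q≤ = ℕP.≤-pred (∈P.∈-upTo⁻ q∈)

  prefix-pivot : ∀ q → q ≤ suc (suc m) → n ∣ℤ T v q → (+ q - + 1) ∈ Piv n v
  prefix-pivot q q≤ n∣T =
    ∈P.∈-filter⁺ (pivotCond? n v) (∈P.∈-map⁺ (λ w → + w - + 1) (∈P.∈-upTo⁺ (s≤s q≤)))
                 (subst (n ∣ℤ_) (sym (sumFromTo-prefix q v q≤)) n∣T)

  h2-lower : ∀ {x} → x ∈ Piv n v → h2 n m v ≤ ∣ + 2 * x - + m ∣
  h2-lower x∈ = foldr⊓ℕ-lower _ _ (∈P.∈-map⁺ (λ p → ∣ + 2 * p - + m ∣) x∈)

  record LeftEnd : Set where
    field
      ql : ℕ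
      pl≡ : pl n m v ≡ + ql - + 1
      n∣T : n ∣ℤ T v ql
      in-left : ql ℕ.+ ql < suc (suc m)
      far : ql ≡ 0 ⊎ h2 n m v ℕ.+ (ql ℕ.+ ql) ≤ suc (suc m)

  record RightEnd : Set where
    field
      qr : ℕ
      pr≡ : pr n m v ≡ + qr - + 1
      qr≤ : qr ≤ suc (suc m)
      n∣T : n ∣ℤ T v qr
      in-right : suc (suc m) ≤ qr ℕ.+ qr
      far : qr ≡ suc (suc m) ⊎ h2 n m v ℕ.+ suc (suc m) ≤ qr ℕ.+ qr

  leftPivots rightPivots : List ℤ
  leftPivots = List.filter (λ p → (+ 2 * p) ℤ.<? + m) (Piv n v)
  rightPivots = List.filter (λ p → + m ℤ.≤? (+ 2 * p)) (Piv n v)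

  left-candidate : ∀ {x} → x ∈ leftPivots →
    ∃ λ q → x ≡ + q - + 1 × n ∣ℤ T v q × q ℕ.+ q < suc (suc m) × h2 n m v ℕ.+ (q ℕ.+ q) ≤ suc (suc m)
  left-candidate {x} x∈ with ∈P.∈-filter⁻ (λ p → (+ 2 * p) ℤ.<? + m) x∈
  ... | piv , lt with pivot-prefix piv
  ... | q , q≤ , x≡ , n∣T with side m q
  ... | left in-left width _ =
    q , x≡ , n∣T , in-left , ℕP.≤-trans (ℕP.+-monoˡ-≤ (q ℕ.+ q) (h2-lower (subst (_∈ Piv n v) x≡ piv))) (ℕP.≤-reflexive width)
  ... | right _ _ m≤ = ⊥-elim (ℤP.<⇒≱ (subst (λ w → + 2 * w ℤ.< + m) x≡ lt) m≤)

  right-candidate : ∀ {x} → x ∈ rightPivots →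
    ∃ λ q → x ≡ + q - + 1 × q ≤ suc (suc m) × n ∣ℤ T v q × suc (suc m) ≤ q ℕ.+ q × h2 n m v ℕ.+ suc (suc m) ≤ q ℕ.+ q
  right-candidate {x} x∈ with ∈P.∈-filter⁻ (λ p → + m ℤ.≤? (+ 2 * p)) x∈
  ... | piv , ge with pivot-prefix piv
  ... | q , q≤ , x≡ , n∣T with side m q
  ... | right in-right width _ =
    q , x≡ , q≤ , n∣T , in-right , ℕP.≤-trans (ℕP.+-monoˡ-≤ (suc (suc m)) (h2-lower (subst (_∈ Piv n v) x≡ piv))) (ℕP.≤-reflexive width)
  ... | left _ _ lt = ⊥-elim (ℤP.<⇒≱ lt (subst (λ w → + m ℤ.≤ + 2 * w) x≡ ge))

  left-end : LeftEnd
  left-end with ∈P.foldr-selective ℤP.⊔-sel ℤ.-1ℤ leftPivots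
  ... | inj₁ pl≡-1 = record { ql = 0 ; pl≡ = pl≡-1 ; n∣T = ℕD.divides 0 refl ; in-left = s≤s z≤n ; far = inj₁ refl }
  ... | inj₂ pl∈ = let q , pl≡ , n∣T , in-left , far = left-candidate pl∈ in
    record { ql = q ; pl≡ = pl≡ ; n∣T = n∣T ; in-left = in-left ; far = inj₂ far }

  right-end : RightEnd
  right-end with ∈P.foldr-selective ℤP.⊓-sel (+ suc m) rightPivots
  ... | inj₁ pr≡m+1 = record { qr = suc (suc m) ; pr≡ = trans pr≡m+1 (sym (+suc-1 (suc m))) ; qr≤ = ℕP.≤-refl
                             ; n∣T = total-divisible ; in-right = ℕP.m≤m+n _ _ ; far = inj₁ refl }
  ... | inj₂ pr∈ = let q , pr≡ , q≤ , n∣T , in-right , far = right-candidate pr∈ in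
    record { qr = q ; pr≡ = pr≡ ; qr≤ = q≤ ; n∣T = n∣T ; in-right = in-right ; far = inj₂ far }

  open LeftEnd left-end public using (ql)
  open RightEnd right-end public using (qr)

  no-pivot-between : ∀ r → ql < r → r < qr → ¬ (n ∣ℤ T v r)
  no-pivot-between r ql<r r<qr n∣T with side m r
  ... | left _ _ lt = ℕP.<⇒≱ ql<r (pred-cancel r ql (subst (+ r - + 1 ℤ.≤_) (LeftEnd.pl≡ left-end)
          (foldr⊔-upper ℤ.-1ℤ leftPivots (∈P.∈-filter⁺ (λ p → (+ 2 * p) ℤ.<? + m) (prefix-pivot r r≤ n∣T) lt))))
    where
    r≤ = ℕP.≤-trans (ℕP.<⇒≤ r<qr) (RightEnd.qr≤ right-end)
  ... | right _ _ ge = ℕP.<⇒≱ r<qr (pred-cancel qr r (subst (ℤ._≤ + r - + 1) (RightEnd.pr≡ right-end)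
          (foldr⊓-lower (+ suc m) rightPivots (∈P.∈-filter⁺ (λ p → + m ℤ.≤? (+ 2 * p)) (prefix-pivot r r≤ n∣T) ge))))
    where
    r≤ = ℕP.≤-trans (ℕP.<⇒≤ r<qr) (RightEnd.qr≤ right-end)

  ql<qr : ql < qr
  ql<qr with ql ℕ.<? qr
  ... | yes lt = lt
  ... | no ≮ = ⊥-elim (ℕP.<⇒≱ (LeftEnd.in-left left-end)
                 (ℕP.≤-trans (RightEnd.in-right right-end) (ℕP.+-mono-≤ (ℕP.≮⇒≥ ≮) (ℕP.≮⇒≥ ≮))))

  rise-by-n : sumIc n m v ≡ + n → T v qr ≡ T v ql + + n
  rise-by-n Ic≡n = begin
      T v qr                       ≡⟨ cancel (T v qr) (T v ql) ⟨
      T v ql + (T v qr - T v ql)   ≡⟨ cong (λ z → T v ql + z) (sumFromTo-interval ql qr v (ℕP.<⇒≤ ql<qr) (RightEnd.qr≤ right-end)) ⟨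
      T v ql + sumFromTo (+ ql) (+ qr - + 1) v
          ≡⟨ cong (λ a → T v ql + sumFromTo a (+ qr - + 1) v) (sym (trans (cong (_+ + 1) (LeftEnd.pl≡ left-end)) (succ-pred (+ ql)))) ⟩
      T v ql + sumFromTo (pl n m v + + 1) (+ qr - + 1) v
          ≡⟨ cong (λ b → T v ql + sumFromTo (pl n m v + + 1) b v) (sym (RightEnd.pr≡ right-end)) ⟩
      T v ql + sumIc n m v         ≡⟨ cong (λ z → T v ql + z) Ic≡n ⟩
      T v ql + + n                 ∎
    where
    open ≡-Reasoning
    cancel : ∀ a b → b + (a - b) ≡ a
    cancel = solve-∀
    succ-pred : ∀ x → x - + 1 + + 1 ≡ x
    succ-pred = solve-∀

module Stretch {n m : ℕ} (v : Tuple m) (isV : IsVertex n m v) (1<n : 1 < n)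
  (p₀ q₀ : ℕ) (p₀<q₀ : p₀ < q₀) (q₀≤ : q₀ ≤ suc (suc m))
  (k : ℤ) (at-p₀ : T v p₀ ≡ k * + n) (at-q₀ : T v q₀ ≡ T v p₀ + + n)
  (no-multiple : ∀ r → p₀ < r → r < q₀ → ¬ (n ∣ℤ T v r)) where

  open Vertex v isV

  rise : ℕ → ℤ
  rise r = T v r - T v p₀

  rise-suc : ∀ r → rise (suc r) ≡ rise r + co v r
  rise-suc r = regroup (T v r) (co v r) (T v p₀)
    where
    regroup : ∀ t a b → t + a - b ≡ t - b + a
    regroup = solve-∀

  rise-at-p₀ : rise p₀ ≡ + 0
  rise-at-p₀ = ℤP.+-inverseʳ (T v p₀)

  rise-at-q₀ : rise q₀ ≡ + n
  rise-at-q₀ = trans (cong (_- T v p₀) at-q₀) (cancel (T v p₀) (+ n))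
    where
    cancel : ∀ a b → a + b - a ≡ b
    cancel = solve-∀

  multiple-rise : ∀ r j → rise r ≡ j * + n → n ∣ℤ T v r
  multiple-rise r j e = multiple⇒∣ℤ _ (k + j) (trans (sym (cancel (T v r) (T v p₀))) (trans (cong₂ _+_ at-p₀ e) (collect k j (+ n))))
    where
    cancel : ∀ a b → b + (a - b) ≡ a
    cancel = solve-∀
    collect : ∀ k j n → k * n + j * n ≡ (k + j) * n
    collect = solve-∀

  before : ∀ r d → 1 ≤ r → r ℕ.+ d ≡ p₀ → ∣ rise r ∣ ≤ d
  before r d 1≤r e = ℕP.≤-trans (ℕP.≤-reflexive (trans (ℤP.∣i-j∣≡∣j-i∣ (T v r) (T v p₀)) (cong (λ w → ∣ T v w - T v r ∣) (sym e))))
                                (drift r d 1≤r (subst (_≤ suc m) (sym e) (ℕP.≤-pred (ℕP.<-≤-trans p₀<q₀ q₀≤))))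

  after : ∀ r d → q₀ ℕ.+ d ≡ r → r ≤ suc m → ∣ rise r - + n ∣ ≤ d
  after r d e r≤ = ℕP.≤-trans (ℕP.≤-reflexive (cong ∣_∣ (trans (regroup (T v r) (T v p₀) (+ n))
                                 (trans (cong (λ w → T v r - w) (sym at-q₀)) (cong (λ w → T v w - T v q₀) (sym e))))))
                              (drift q₀ d (ℕP.≤-trans (s≤s z≤n) p₀<q₀) (subst (_≤ suc m) (sym e) r≤))
    where
    regroup : ∀ a b c → a - b - c ≡ a - (b + c)
    regroup = solve-∀

  Above : ℕ → Set
  Above r = ∃ λ a → rise r ≡ + suc a × suc a < n

  Below : ℕ → Set
  Below r = ∃ λ a → rise r ≡ -[1+ a ] × suc a < n

  -- a unit step cannot leave (0, n) or (−n, 0) without creating a pivot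
  above-step : ∀ r → 1 ≤ r → r ≤ m → suc r < q₀ → p₀ < r → Above r → Above (suc r)
  above-step r 1≤r r≤m r+1<q₀ p₀<r (a , e , a<n) with middle-trit r 1≤r r≤m
  ... | inj₁ down with a
  ...   | zero = ⊥-elim (no-multiple (suc r) (ℕP.m<n⇒m<1+n p₀<r) r+1<q₀
                   (multiple-rise (suc r) (+ 0) (trans (rise-suc r) (trans (cong₂ _+_ e down) (sym (ℤP.*-zeroˡ (+ n)))))))
  ...   | suc b = b , trans (rise-suc r) (cong₂ _+_ e down) , ℕP.<-trans (ℕP.n<1+n (suc b)) a<n
  above-step r 1≤r r≤m r+1<q₀ p₀<r (a , e , a<n) | inj₂ (inj₁ flat) =
    a , trans (rise-suc r) (trans (cong₂ _+_ e flat) (ℤP.+-identityʳ _)) , a<n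
  above-step r 1≤r r≤m r+1<q₀ p₀<r (a , e , a<n) | inj₂ (inj₂ up) =
    suc a , up-by-one , ℕP.≤∧≢⇒< a<n (λ eq → no-multiple (suc r) (ℕP.m<n⇒m<1+n p₀<r) r+1<q₀
                                         (multiple-rise (suc r) (+ 1) (trans up-by-one (trans (cong +_ eq) (sym (ℤP.*-identityˡ (+ n)))))))
    where
    up-by-one : rise (suc r) ≡ + suc (suc a)
    up-by-one = trans (rise-suc r) (trans (cong₂ _+_ e up) (cong +_ (ℕP.+-comm (suc a) 1)))

  below-step : ∀ r → 1 ≤ r → r ≤ m → suc r < q₀ → p₀ < r → Below r → Below (suc r)
  below-step r 1≤r r≤m r+1<q₀ p₀<r (a , e , a<n) with middle-trit r 1≤r r≤m
  ... | inj₂ (inj₂ up) with a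
  ...   | zero = ⊥-elim (no-multiple (suc r) (ℕP.m<n⇒m<1+n p₀<r) r+1<q₀
                   (multiple-rise (suc r) (+ 0) (trans (rise-suc r) (trans (cong₂ _+_ e up) (sym (ℤP.*-zeroˡ (+ n)))))))
  ...   | suc b = b , trans (rise-suc r) (cong₂ _+_ e up) , ℕP.<-trans (ℕP.n<1+n (suc b)) a<n
  below-step r 1≤r r≤m r+1<q₀ p₀<r (a , e , a<n) | inj₂ (inj₁ flat) =
    a , trans (rise-suc r) (trans (cong₂ _+_ e flat) (ℤP.+-identityʳ _)) , a<n
  below-step r 1≤r r≤m r+1<q₀ p₀<r (a , e , a<n) | inj₁ down =
    suc a , down-by-one , ℕP.≤∧≢⇒< a<n (λ eq → no-multiple (suc r) (ℕP.m<n⇒m<1+n p₀<r) r+1<q₀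
                                           (multiple-rise (suc r) ℤ.-1ℤ (trans down-by-one (trans (cong (-_ ∘ +_) eq) (sym (ℤP.-1*i≡-i (+ n)))))))
    where
    down-by-one : rise (suc r) ≡ -[1+ suc a ]
    down-by-one = trans (rise-suc r) (trans (cong₂ _+_ e down) (cong -[1+_] (cong suc (ℕP.+-identityʳ a))))

  first-rise : rise (suc p₀) ≡ co v p₀
  first-rise = trans (rise-suc p₀) (trans (cong (_+ co v p₀) rise-at-p₀) (ℤP.+-identityˡ _))

  first-rise-nonzero : suc p₀ < q₀ → rise (suc p₀) ≡ + 0 → ⊥
  first-rise-nonzero p₀+1<q₀ e =
    no-multiple (suc p₀) ℕP.≤-refl p₀+1<q₀ (multiple-rise (suc p₀) (+ 0) (trans e (sym (ℤP.*-zeroˡ (+ n)))))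

  -- the first step after p₀ leaves 0 (it would otherwise be a pivot) by less than n
  first-step : suc p₀ < q₀ → Above (suc p₀) ⊎ Below (suc p₀)
  first-step p₀+1<q₀ with p₀ ℕ.≟ 0
  ... | yes refl = from-first (co v 0) refl first-range
    where
    from-first : ∀ x → co v 0 ≡ x → (+ 0 ℤ.≤ x) × (x ℤ.< + n) → Above 1 ⊎ Below 1
    from-first (+ zero) e _ = ⊥-elim (first-rise-nonzero p₀+1<q₀ (trans first-rise e))
    from-first (+ suc a) e (_ , a<n) = inj₁ (a , trans first-rise e , ℤP.drop‿+<+ a<n)
    from-first -[1+ a ] e (() , _)
  ... | no p₀≢0 with middle-trit p₀ (ℕP.n≢0⇒n>0 p₀≢0) (ℕP.≤-pred (ℕP.≤-pred (ℕP.≤-trans p₀+1<q₀ q₀≤)))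
  ...   | inj₁ down = inj₂ (0 , trans first-rise down , 1<n)
  ...   | inj₂ (inj₁ flat) = ⊥-elim (first-rise-nonzero p₀+1<q₀ (trans first-rise flat))
  ...   | inj₂ (inj₂ up) = inj₁ (0 , trans first-rise up , 1<n)

  persist : (P : ℕ → Set) → (∀ r → 1 ≤ r → r ≤ m → suc r < q₀ → p₀ < r → P r → P (suc r)) →
            ∀ d → P (suc p₀) → suc p₀ ℕ.+ d < q₀ → P (suc p₀ ℕ.+ d)
  persist P preserve zero P₁ _ = subst P (sym (ℕP.+-identityʳ (suc p₀))) P₁
  persist P preserve (suc d) P₁ lt = subst P (sym (ℕP.+-suc (suc p₀) d))
    (preserve (suc p₀ ℕ.+ d) (s≤s z≤n) (ℕP.≤-pred (ℕP.≤-pred (ℕP.≤-trans lt′ q₀≤))) lt′ (s≤s (ℕP.m≤m+n p₀ d))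
          (persist P preserve d P₁ (ℕP.<-trans (ℕP.n<1+n _) lt′)))
    where
    lt′ : suc (suc p₀ ℕ.+ d) < q₀
    lt′ = subst (_< q₀) (ℕP.+-suc (suc p₀) d) lt

  -- the rise cannot be negative just before q₀, where it reaches n with a step < n
  below-blocked : ∀ r → Below r → suc r ≡ q₀ → 1 ≤ r → ⊥
  below-blocked r (a , e , _) r+1≡q₀ 1≤r =
    ℤP.<-irrefl refl (subst (ℤ._< + n) (trans (sym (rise-suc r)) (trans (cong rise r+1≡q₀) rise-at-q₀)) rises-less)
    where
    step<n : co v r ℤ.< + n
    step<n with r ℕ.≤? m
    ... | yes r≤m = trit<n _ (middle-trit r 1≤r r≤m)
      where
      trit<n : ∀ x → Trit x → x ℤ.< + n
      trit<n _ (inj₁ refl) = ℤ.-<+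
      trit<n _ (inj₂ (inj₁ refl)) = ℤ.+<+ (ℕP.<-trans (s≤s z≤n) 1<n)
      trit<n _ (inj₂ (inj₂ refl)) = ℤ.+<+ 1<n
    ... | no r≰m = subst (λ w → co v w ℤ.< + n)
                         (ℕP.≤-antisym (ℕP.≰⇒> r≰m) (ℕP.≤-pred (subst (_≤ suc (suc m)) (sym r+1≡q₀) q₀≤))) (proj₂ last-range)
    rises-less : rise r + co v r ℤ.< + n
    rises-less = subst (λ w → w + co v r ℤ.< + n) (sym e) (ℤP.+-mono-< { -[1+ a ]} {+ 0} ℤ.-<+ step<n)

  inside : ∀ r → p₀ < r → r < q₀ → (+ 0 ℤ.≤ rise r) × (rise r ℤ.≤ + n)
  inside r p₀<r r<q₀ with ℕP.m≤n⇒∃[o]m+o≡n p₀<r | first-step (ℕP.<-≤-trans (s≤s p₀<r) r<q₀)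
  ... | d , r≡ | inj₁ above with subst Above r≡ (persist Above above-step d above (subst (_< q₀) (sym r≡) r<q₀))
  ...   | a , e , a<n = subst (+ 0 ℤ.≤_) (sym e) (ℤ.+≤+ z≤n) , subst (ℤ._≤ + n) (sym e) (ℤ.+≤+ (ℕP.<⇒≤ a<n))
  inside r p₀<r r<q₀ | _ | inj₂ below with ℕP.m≤n⇒∃[o]m+o≡n (ℕP.<-≤-trans (s≤s p₀<r) r<q₀)
  ... | d′ , q₀≡ = ⊥-elim (below-blocked (suc p₀ ℕ.+ d′) (persist Below below-step d′ below (subst (_≤ q₀) (sym q₀≡) ℕP.≤-refl))
                                         q₀≡ (s≤s z≤n))

-- Zone n t e p y: the value y of the p-th partial sum (measured from a multiple of n)
-- lies in [0, n], or within D of 0 where p + D = t, or within D of n where p = t + n + e + D.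
Zone : ℕ → ℕ → ℕ → ℕ → ℤ → Set
Zone n t e p y = ((+ 0 ℤ.≤ y) × (y ℤ.≤ + n))
               ⊎ (∃ λ D → p ℕ.+ D ≡ t × ∣ y ∣ ≤ D)
               ⊎ (∃ λ D → t ℕ.+ n ℕ.+ e ℕ.+ D ≡ p × ∣ y - + n ∣ ≤ D)

-- Under the hypotheses of the theorem, with m = n + 2t + e, the pivot p_l is at most t and
-- p_r at least t + n + e, so every partial sum of v lies in its zone.
module CentralInterval {n m : ℕ} (v : Tuple m) (isV : IsVertex n m v) (1<n : 1 < n)
  (t e : ℕ) (m≡ : m ≡ n ℕ.+ (t ℕ.+ t) ℕ.+ e) (h≥ : n ℕ.+ e ≤ h2 n m v) (Ic≡n : sumIc n m v ≡ + n) where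

  open Pivots v isV
  open LeftEnd left-end using (far; n∣T)
  open RightEnd right-end using (far; qr≤; n∣T)

  -- h(v) ≥ h_{n,m} keeps both pivots away from the centre
  ql≤ : ql ≤ suc t
  ql≤ with LeftEnd.far left-end
  ... | inj₁ ql≡0 = subst (_≤ suc t) (sym ql≡0) z≤n
  ... | inj₂ bound = halve ql (suc t) (ℕP.+-cancelˡ-≤ (n ℕ.+ e) _ _
                       (ℕP.≤-trans (ℕP.+-monoˡ-≤ (ql ℕ.+ ql) h≥) (ℕP.≤-trans bound (ℕP.≤-reflexive (trans (cong (suc ∘ suc) m≡) (regroup n t e))))))
    where
    regroup : ∀ n t e → suc (suc (n ℕ.+ (t ℕ.+ t) ℕ.+ e)) ≡ n ℕ.+ e ℕ.+ (suc t ℕ.+ suc t)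
    regroup = solveℕ

  qr≥ : suc (t ℕ.+ n ℕ.+ e) ≤ qr
  qr≥ with RightEnd.far right-end
  ... | inj₁ qr≡ = subst (suc (t ℕ.+ n ℕ.+ e) ≤_) (sym qr≡)
                         (ℕP.≤-trans (ℕP.m≤m+n _ t) (ℕP.≤-trans (ℕP.≤-reflexive (trans (regroup t n e) (cong suc (sym m≡)))) (ℕP.n≤1+n _)))
    where
    regroup : ∀ t n e → suc (t ℕ.+ n ℕ.+ e) ℕ.+ t ≡ suc (n ℕ.+ (t ℕ.+ t) ℕ.+ e)
    regroup = solveℕ
  ... | inj₂ bound = halve (suc (t ℕ.+ n ℕ.+ e)) qr
                       (ℕP.≤-trans (ℕP.≤-reflexive (sym (trans (cong (λ w → n ℕ.+ e ℕ.+ suc (suc w)) m≡) (regroup n t e))))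
                                   (ℕP.≤-trans (ℕP.+-monoˡ-≤ (suc (suc m)) h≥) bound))
    where
    regroup : ∀ n t e → n ℕ.+ e ℕ.+ suc (suc (n ℕ.+ (t ℕ.+ t) ℕ.+ e)) ≡ suc (t ℕ.+ n ℕ.+ e) ℕ.+ suc (t ℕ.+ n ℕ.+ e)
    regroup = solveℕ

  k : ℤ
  k = proj₁ (∣ℤ⇒multiple (T v ql) (LeftEnd.n∣T left-end))

  open Stretch v isV 1<n ql qr ql<qr (RightEnd.qr≤ right-end) k (proj₂ (∣ℤ⇒multiple (T v ql) (LeftEnd.n∣T left-end)))
               (rise-by-n Ic≡n) no-pivot-between

  rise≡ : ∀ r → rise r ≡ T v r - k * + n
  rise≡ r = cong (λ w → T v r - w) (proj₂ (∣ℤ⇒multiple (T v ql) (LeftEnd.n∣T left-end)))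

  zones : ∀ p → p ≤ m → Zone n t e p (T v (suc p) - k * + n)
  zones p p≤m with suc p ℕ.≤? ql
  ... | yes p<ql = inj₂ (inj₁ (d ℕ.+ s , p+d+s≡t , ℕP.≤-trans (subst (λ w → ∣ w ∣ ≤ d) (rise≡ (suc p)) (before (suc p) d (s≤s z≤n) p+d≡))
                                                              (ℕP.m≤m+n d s)))
    where
    d = proj₁ (ℕP.m≤n⇒∃[o]m+o≡n p<ql)
    p+d≡ = proj₂ (ℕP.m≤n⇒∃[o]m+o≡n p<ql)
    p+d≤t : p ℕ.+ d ≤ t
    p+d≤t = ℕP.≤-pred (subst (_≤ suc t) (sym p+d≡) ql≤)
    s = proj₁ (ℕP.m≤n⇒∃[o]m+o≡n p+d≤t)
    p+d+s≡t : p ℕ.+ (d ℕ.+ s) ≡ t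
    p+d+s≡t = trans (sym (ℕP.+-assoc p d s)) (proj₂ (ℕP.m≤n⇒∃[o]m+o≡n p+d≤t))
  ... | no p≮ql with suc p ℕ.<? qr
  ...   | yes p<qr = inj₁ (subst (λ w → (+ 0 ℤ.≤ w) × (w ℤ.≤ + n)) (rise≡ (suc p)) (inside (suc p) (ℕP.≰⇒> p≮ql) p<qr))
  ...   | no p≮qr = inj₂ (inj₂ (s ℕ.+ d , t+n+e+s+d≡p ,
                         ℕP.≤-trans (subst (λ w → ∣ w - + n ∣ ≤ d) (rise≡ (suc p)) (after (suc p) d qr+d≡ (s≤s p≤m))) (ℕP.m≤n+m d s)))
    where
    d = proj₁ (ℕP.m≤n⇒∃[o]m+o≡n (ℕP.≮⇒≥ p≮qr))
    qr+d≡ = proj₂ (ℕP.m≤n⇒∃[o]m+o≡n (ℕP.≮⇒≥ p≮qr))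
    s = proj₁ (ℕP.m≤n⇒∃[o]m+o≡n qr≥)
    t+n+e+s≡qr = proj₂ (ℕP.m≤n⇒∃[o]m+o≡n qr≥)
    t+n+e+s+d≡p : t ℕ.+ n ℕ.+ e ℕ.+ (s ℕ.+ d) ≡ p
    t+n+e+s+d≡p = ℕP.suc-injective (trans (cong suc (sym (ℕP.+-assoc (t ℕ.+ n ℕ.+ e) s d))) (trans (cong (ℕ._+ d) t+n+e+s≡qr) qr+d≡))

-- g(x) = |x| + |x − n|: the cost of a partial sum x at the two levels 0 and n together
g : ℕ → ℤ → ℕ
g n x = ∣ x ∣ ℕ.+ ∣ x - + n ∣

abs-nonneg : ∀ x → + 0 ℤ.≤ x → + ∣ x ∣ ≡ x
abs-nonneg x = ℤP.0≤i⇒+∣i∣≡i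

abs-nonpos : ∀ x → x ℤ.≤ + 0 → + ∣ x ∣ ≡ - x
abs-nonpos x x≤0 = trans (cong +_ (sym (ℤP.∣-i∣≡∣i∣ x))) (abs-nonneg (- x) (ℤP.neg-mono-≤ x≤0))

abs-same-sign : ∀ a b → (+ 0 ℤ.≤ a × + 0 ℤ.≤ b) ⊎ (a ℤ.≤ + 0 × b ℤ.≤ + 0) → ∣ a ∣ ℕ.+ ∣ b ∣ ≡ ∣ a + b ∣
abs-same-sign a b (inj₁ (0≤a , 0≤b)) = ℤP.+-injective
  (trans (ℤP.pos-+ ∣ a ∣ ∣ b ∣) (trans (cong₂ _+_ (abs-nonneg a 0≤a) (abs-nonneg b 0≤b)) (sym (abs-nonneg (a + b) (ℤP.+-mono-≤ 0≤a 0≤b)))))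
abs-same-sign a b (inj₂ (a≤0 , b≤0)) = ℤP.+-injective
  (trans (ℤP.pos-+ ∣ a ∣ ∣ b ∣) (trans (cong₂ _+_ (abs-nonpos a a≤0) (abs-nonpos b b≤0))
         (trans (sym (ℤP.neg-distrib-+ a b)) (sym (abs-nonpos (a + b) (ℤP.+-mono-≤ a≤0 b≤0))))))

g-outside : ∀ n x → (x ℤ.≤ + 0 ⊎ + n ℤ.≤ x) → g n x ≡ ∣ x + (x - + n) ∣
g-outside n x (inj₁ x≤0) = abs-same-sign x (x - + n) (inj₂ (x≤0 , ℤP.i≤j⇒i-k≤j (+ n) x≤0))
g-outside n x (inj₂ n≤x) = abs-same-sign x (x - + n) (inj₁ (ℤP.≤-trans (ℤ.+≤+ z≤n) n≤x , ℤP.i≤j⇒0≤j-i n≤x))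

g-inside : ∀ n x → + 0 ℤ.≤ x → x ℤ.≤ + n → g n x ≡ n
g-inside n x 0≤x x≤n = ℤP.+-injective (trans (ℤP.pos-+ ∣ x ∣ ∣ x - + n ∣)
  (trans (cong₂ _+_ (abs-nonneg x 0≤x) (abs-nonpos (x - + n) (ℤP.i≤j⇒i-j≤0 x≤n))) (cancel x (+ n))))
  where
  cancel : ∀ x n → x + - (x - n) ≡ n
  cancel = solve-∀

g-least : ∀ n x → n ≤ g n x
g-least n x = ℕP.≤-trans (ℕP.≤-reflexive (cong ∣_∣ (sym (cancel x (+ n))))) (ℤP.∣i-j∣≤∣i∣+∣j∣ x (x - + n))
  where
  cancel : ∀ x n → x - (x - n) ≡ n
  cancel = solve-∀

g-near-0 : ∀ n y D → ∣ y ∣ ≤ D → g n y ≤ D ℕ.+ (D ℕ.+ n)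
g-near-0 n y D h = ℕP.+-mono-≤ h (ℕP.≤-trans (ℤP.∣i-j∣≤∣i∣+∣j∣ y (+ n)) (ℕP.+-monoˡ-≤ n h))

g-near-n : ∀ n y D → ∣ y - + n ∣ ≤ D → g n y ≤ (D ℕ.+ n) ℕ.+ D
g-near-n n y D h = ℕP.+-mono-≤ (ℕP.≤-trans (ℕP.≤-reflexive (cong ∣_∣ (sym (cancel y (+ n)))))
                                (ℕP.≤-trans (ℤP.∣i+j∣≤∣i∣+∣j∣ (y - + n) (+ n)) (ℕP.+-monoˡ-≤ n h))) h
  where
  cancel : ∀ y n → y - n + n ≡ y
  cancel = solve-∀

g-at-−D : ∀ n D → g n (- + D) ≡ D ℕ.+ (D ℕ.+ n)
g-at-−D n D = cong₂ ℕ._+_ (ℤP.∣-i∣≡∣i∣ (+ D))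
  (trans (cong ∣_∣ (trans (regroup (+ D) (+ n)) (cong -_ (sym (ℤP.pos-+ D n))))) (ℤP.∣-i∣≡∣i∣ (+ (D ℕ.+ n))))
  where
  regroup : ∀ d n → - d - n ≡ - (d + n)
  regroup = solve-∀

g-at-n+D : ∀ n D → g n (+ D + + n) ≡ (D ℕ.+ n) ℕ.+ D
g-at-n+D n D = cong₂ ℕ._+_ (cong ∣_∣ (sym (ℤP.pos-+ D n))) (cong ∣_∣ (cancel (+ D) (+ n)))
  where
  cancel : ∀ d n → d + n - n ≡ d
  cancel = solve-∀

g-zone : ∀ n t e p y x → Zone n t e p y →
         (∀ D → p ℕ.+ D ≡ t → g n x ≡ D ℕ.+ (D ℕ.+ n)) → (∀ D → t ℕ.+ n ℕ.+ e ℕ.+ D ≡ p → g n x ≡ (D ℕ.+ n) ℕ.+ D) →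
         g n y ≤ g n x
g-zone n t e p y x (inj₁ (0≤y , y≤n)) _ _ = ℕP.≤-trans (ℕP.≤-reflexive (g-inside n y 0≤y y≤n)) (g-least n x)
g-zone n t e p y x (inj₂ (inj₁ (D , p+D≡t , near))) at-0 _ = ℕP.≤-trans (g-near-0 n y D near) (ℕP.≤-reflexive (sym (at-0 D p+D≡t)))
g-zone n t e p y x (inj₂ (inj₂ (D , p≡ , near))) _ at-n = ℕP.≤-trans (g-near-n n y D near) (ℕP.≤-reflexive (sym (at-n D p≡)))

odd-multiple : ∀ n j → n ≤ ∣ (+ 1 - (j + j)) * + n ∣
odd-multiple n j = ℕP.≤-trans (ℕP.≤-reflexive (sym (ℕP.*-identityˡ n)))
                              (ℕP.≤-trans (ℕP.*-monoˡ-≤ n (nonzero j)) (ℕP.≤-reflexive (sym (ℤP.abs-* (+ 1 - (j + j)) (+ n)))))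
  where
  not-even : ∀ j → ¬ (+ 1 ≡ j + j)
  not-even (+ zero) ()
  not-even (+ suc k) e = ℕP.1+n≢0 (sym (ℕP.suc-injective (trans (ℤP.+-injective e) (ℕP.+-suc (suc k) k))))
  not-even -[1+ k ] ()
  nonzero : ∀ j → 1 ≤ ∣ + 1 - (j + j) ∣
  nonzero j with ∣ + 1 - (j + j) ∣ in eq
  ... | suc _ = s≤s z≤n
  ... | zero = ⊥-elim (not-even j (ℤP.i-j≡0⇒i≡j (+ 1) (j + j) (ℤP.∣i∣≡0⇒i≡0 eq)))

split-at : ∀ n x → (x ℤ.≤ + 0 ⊎ + n ℤ.≤ x) ⊎ (+ 0 ℤ.≤ x × x ℤ.≤ + n)
split-at n x with x ℤ.≤? + 0 | + n ℤ.≤? x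
... | yes x≤0 | _ = inj₁ (inj₁ x≤0)
... | no _ | yes n≤x = inj₁ (inj₂ n≤x)
... | no x≰0 | no n≰x = inj₂ (ℤP.<⇒≤ (ℤP.≰⇒> x≰0) , ℤP.<⇒≤ (ℤP.≰⇒> n≰x))

-- If x + x′ = n then, at every level c = j·n, g(x) ≤ |x − c| + |x′ − c|:
-- the two-level cost of x is paid by the costs of a complementary pair at a single level.
g-pair : ∀ n x x′ j → x + x′ ≡ + n → g n x ≤ ∣ x - j * + n ∣ ℕ.+ ∣ x′ - j * + n ∣
g-pair n x x′ j sum with split-at n x
... | inj₁ outside = ℕP.≤-trans (ℕP.≤-reflexive (trans (g-outside n x outside) (cong ∣_∣ (difference x x′ j (+ n) sum))))
                                (ℤP.∣i-j∣≤∣i∣+∣j∣ (x - j * + n) (x′ - j * + n))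
  where
  difference : ∀ x x′ j n → x + x′ ≡ n → x + (x - n) ≡ (x - j * n) - (x′ - j * n)
  difference x x′ j n e = trans (cong (λ w → x + (x - w)) (sym e)) (regroup x x′ j n)
    where
    regroup : ∀ x x′ j n → x + (x - (x + x′)) ≡ (x - j * n) - (x′ - j * n)
    regroup = solve-∀
... | inj₂ (0≤x , x≤n) = ℕP.≤-trans (ℕP.≤-reflexive (g-inside n x 0≤x x≤n))
                           (ℕP.≤-trans (odd-multiple n j)
                             (ℕP.≤-trans (ℕP.≤-reflexive (cong ∣_∣ (total x x′ j (+ n) sum))) (ℤP.∣i+j∣≤∣i∣+∣j∣ (x - j * + n) (x′ - j * + n))))
  where
  total : ∀ x x′ j n → x + x′ ≡ n → (+ 1 - (j + j)) * n ≡ (x - j * n) + (x′ - j * n)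
  total x x′ j n e = trans (regroup j n) (trans (cong (λ w → w - (j + j) * n) (sym e)) (regroup′ x x′ j n))
    where
    regroup : ∀ j n → (+ 1 - (j + j)) * n ≡ n - (j + j) * n
    regroup = solve-∀
    regroup′ : ∀ x x′ j n → x + x′ - (j + j) * n ≡ (x - j * n) + (x′ - j * n)
    regroup′ = solve-∀

g-pair+1 : ∀ n x x′ j → x + x′ ≡ + n + + 1 → g n x ≤ ∣ x - j * + n ∣ ℕ.+ ∣ x′ - j * + n ∣ ℕ.+ 1
g-pair+1 n x x′ j sum with split-at n x
... | inj₁ outside = ℕP.≤-trans (ℕP.≤-reflexive (trans (g-outside n x outside) (cong ∣_∣ (difference x x′ j (+ n) sum))))
                       (ℕP.≤-trans (ℤP.∣i+j∣≤∣i∣+∣j∣ (a - a′) (+ 1)) (ℕP.+-monoˡ-≤ 1 (ℤP.∣i-j∣≤∣i∣+∣j∣ a a′)))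
  where
  a = x - j * + n
  a′ = x′ - j * + n
  difference : ∀ x x′ j n → x + x′ ≡ n + + 1 → x + (x - n) ≡ ((x - j * n) - (x′ - j * n)) + + 1
  difference x x′ j n e = trans (cong (λ w → x + (x - w)) (sym (cancel n)))
                                (trans (cong (λ w → x + (x - (w - + 1))) (sym e)) (regroup x x′ j n))
    where
    cancel : ∀ n → n + + 1 - + 1 ≡ n
    cancel = solve-∀
    regroup : ∀ x x′ j n → x + (x - (x + x′ - + 1)) ≡ ((x - j * n) - (x′ - j * n)) + + 1
    regroup = solve-∀
... | inj₂ (0≤x , x≤n) = ℕP.≤-trans (ℕP.≤-reflexive (g-inside n x 0≤x x≤n)) (ℕP.≤-trans (odd-multiple n j)
                           (ℕP.≤-trans (ℕP.≤-reflexive (cong ∣_∣ (total x x′ j (+ n) sum)))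
                             (ℕP.≤-trans (ℤP.∣i-j∣≤∣i∣+∣j∣ (a + a′) (+ 1)) (ℕP.+-monoˡ-≤ 1 (ℤP.∣i+j∣≤∣i∣+∣j∣ a a′)))))
  where
  a = x - j * + n
  a′ = x′ - j * + n
  total : ∀ x x′ j n → x + x′ ≡ n + + 1 → (+ 1 - (j + j)) * n ≡ (x - j * n) + (x′ - j * n) - + 1
  total x x′ j n e = trans (regroup j n) (trans (cong (λ w → w - (j + j) * n - + 1) (sym e)) (regroup′ x x′ j n))
    where
    regroup : ∀ j n → (+ 1 - (j + j)) * n ≡ (n + + 1) - (j + j) * n - + 1
    regroup = solve-∀
    regroup′ : ∀ x x′ j n → x + x′ - (j + j) * n - + 1 ≡ (x - j * n) + (x′ - j * n) - + 1
    regroup′ = solve-∀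

-- What the comparison needs from a vertex u: a profile X whose two-level costs are paid by
-- the costs of u at any single level (paired), and which sits exactly on the boundary of
-- the zones of the theorem (at-0, at-n).
record Reference (n m t e : ℕ) (u : Tuple m) : Set where
  field
    X : ℕ → ℤ
    paired : ∀ j → Σℕ (λ p → g n (X p)) (suc m) ≤ C n m u j ℕ.+ C n m u j ℕ.+ 1
    at-0 : ∀ p D → p ℕ.+ D ≡ t → g n (X p) ≡ D ℕ.+ (D ℕ.+ n)
    at-n : ∀ p D → t ℕ.+ n ℕ.+ e ℕ.+ D ≡ p → g n (X p) ≡ (D ℕ.+ n) ℕ.+ D

DistLe-weaken : ∀ {n m u w c L} → DistLe n m u w c → c ≤ L → DistLe n m u w L
DistLe-weaken (len , len≤c , walk) c≤L = len , ℕP.≤-trans len≤c c≤L , walk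

a+b≤2c+1 : ∀ a b c → a ℕ.+ b ≤ c ℕ.+ c ℕ.+ 1 → a ≤ c ⊎ b ≤ c
a+b≤2c+1 a b c h with a ℕ.≤? c | b ℕ.≤? c
... | yes a≤c | _ = inj₁ a≤c
... | no _ | yes b≤c = inj₂ b≤c
... | no a≰c | no b≰c = ⊥-elim (ℕP.<⇒≱ (ℕP.≤-trans (ℕP.≤-reflexive (regroup c)) (ℕP.+-mono-≤ (ℕP.≰⇒> a≰c) (ℕP.≰⇒> b≰c))) h)
  where
  regroup : ∀ c → suc (c ℕ.+ c ℕ.+ 1) ≡ suc c ℕ.+ suc c
  regroup = solveℕ

-- If the partial sums of v lie in their zones around the level k·n
-- and u has a reference profile X, then
--   C(v, k) + C(v, k+1) = Σ_p g(y_p) ≤ Σ_p g(X_p) ≤ 2·C(u, j) + 1,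
-- so one of C(v, k), C(v, k+1) is at most C(u, j); by the two cost bounds, any walk from u
-- to 0 is at least as long as some walk from v to 0.
dominated : ∀ {n m} .{{_ : NonZero n}} (v : Tuple m) → IsVertex n m v → ∀ t e k →
            (∀ p → p ≤ m → Zone n t e p (T v (suc p) - k * + n)) →
            ∀ {u} → Reference n m t e u → ∀ {L} → Walk n m u (zeroV m) L → DistLe n m v (zeroV m) L
dominated {n} {m} v isV t e k zones {u} ref walk with cost-lower walk
... | j , Cu≤L with a+b≤2c+1 (C n m v k) (C n m v (k + + 1)) (C n m u j) (ℕP.≤-trans v-costs (paired j))
  where
  open Reference ref
  y : ℕ → ℤ
  y p = T v (suc p) - k * + n
  next-level : ∀ a k n → a - (k + + 1) * n ≡ a - k * n - n
  next-level = solve-∀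
  v-costs : C n m v k ℕ.+ C n m v (k + + 1) ≤ Σℕ (λ p → g n (X p)) (suc m)
  v-costs = begin
      C n m v k ℕ.+ C n m v (k + + 1)   ≡⟨ Σℕ-+ _ _ (suc m) ⟨
      Σℕ (λ p → ∣ y p ∣ ℕ.+ ∣ T v (suc p) - (k + + 1) * + n ∣) (suc m)
          ≡⟨ Σℕ-cong (suc m) (λ p _ → cong (λ z → ∣ y p ∣ ℕ.+ ∣ z ∣) (next-level (T v (suc p)) k (+ n))) ⟩
      Σℕ (λ p → g n (y p)) (suc m)       ≤⟨ Σℕ-mono (suc m) (λ p p≤m → g-zone n t e p (y p) (X p) (zones p (ℕP.≤-pred p≤m)) (at-0 p) (at-n p)) ⟩
      Σℕ (λ p → g n (X p)) (suc m)       ∎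
    where open ℕP.≤-Reasoning
... | inj₁ Cv≤Cu = DistLe-weaken (Profile.cost-upper n m v isV k) (ℕP.≤-trans Cv≤Cu Cu≤L)
... | inj₂ Cv≤Cu = DistLe-weaken (Profile.cost-upper n m v isV (k + + 1)) (ℕP.≤-trans Cv≤Cu Cu≤L)

prefix-of-ones : ∀ {m} (u : Tuple m) (w : ℕ → ℕ) → (∀ i → 1 ≤ i → i ≤ m → co u i ≡ + 1 - + w i) →
                 ∀ p → p ≤ m → T u (suc p) ≡ co u 0 + + p - + Σℕ (w ∘ suc) p
prefix-of-ones u w middle zero _ = trans (ℤP.+-identityˡ (co u 0)) (sym (trans (ℤP.+-identityʳ _) (ℤP.+-identityʳ (co u 0))))
prefix-of-ones u w middle (suc p) p<m =
  trans (cong₂ _+_ (prefix-of-ones u w middle p (ℕP.<⇒≤ p<m)) (middle (suc p) (s≤s z≤n) p<m))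
        (trans (regroup (co u 0) (+ p) (+ Σℕ (w ∘ suc) p) (+ w (suc p)))
               (cong₂ (λ a b → co u 0 + a - b) (sym (ℤP.pos-+ 1 p)) (sym (ℤP.pos-+ (Σℕ (w ∘ suc) p) (w (suc p))))))
  where
  regroup : ∀ a p W x → a + p - W + (+ 1 - x) ≡ a + (+ 1 + p) - (W + x)
  regroup = solve-∀

cost-of-ones : ∀ {n m} (u : Tuple m) (w : ℕ → ℕ) (t : ℕ) (q : ℤ) →
  (∀ i → 1 ≤ i → i ≤ m → co u i ≡ + 1 - + w i) → co u 0 ≡ - + t + q * + n →
  ∀ j → C n m u j ≡ Σℕ (λ p → ∣ + p - + t - + Σℕ (w ∘ suc) p - (j - q) * + n ∣) (suc m)
cost-of-ones {n} u w t q middle first j = Σℕ-cong _ (λ p p≤m → cong ∣_∣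
  (trans (cong (λ z → z - j * + n) (trans (prefix-of-ones u w middle p (ℕP.≤-pred p≤m)) (cong (λ z → z + + p - + Σℕ (w ∘ suc) p) first)))
         (regroup (+ t) q (+ n) (+ p) (+ Σℕ (w ∘ suc) p) j)))
  where
  regroup : ∀ t q n p b j → - t + q * n + p - b - j * n ≡ p - t - b - (j - q) * n
  regroup = solve-∀

-- Pairing p with m − p.  If C(u, j) = Σ_p |X_p − (j − q)·n| and X_p + X_{m−p} = n for all p ≤ m
-- except one position c where it is n + 1, then Σ_p g(X_p) ≤ 2·C(u, j) + 1.
paired-bound : ∀ {n m} (u : Tuple m) (X : ℕ → ℤ) (q : ℤ) (c : ℕ) →
  (∀ j → C n m u j ≡ Σℕ (λ p → ∣ X p - (j - q) * + n ∣) (suc m)) →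
  (∀ p → p ≤ m → (X p + X (m ∸ p) ≡ + n) ⊎ ((X p + X (m ∸ p) ≡ + n + + 1) × p ≡ c)) →
  ∀ j → Σℕ (λ p → g n (X p)) (suc m) ≤ C n m u j ℕ.+ C n m u j ℕ.+ 1
paired-bound {n} {m} u X q c costs pairs j = begin
    Σℕ (λ p → g n (X p)) (suc m)                       ≤⟨ Σℕ-mono (suc m) termwise ⟩
    Σℕ (λ p → F p ℕ.+ F (m ∸ p) ℕ.+ ind c p) (suc m)   ≡⟨ trans (Σℕ-+ _ _ (suc m)) (cong (ℕ._+ Σℕ (ind c) (suc m)) (Σℕ-+ _ _ (suc m))) ⟩
    Σℕ F (suc m) ℕ.+ Σℕ (λ p → F (m ∸ p)) (suc m) ℕ.+ Σℕ (ind c) (suc m)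
        ≤⟨ ℕP.+-monoʳ-≤ _ (Σind≤1 c (suc m)) ⟩
    Σℕ F (suc m) ℕ.+ Σℕ (λ p → F (m ∸ p)) (suc m) ℕ.+ 1
        ≡⟨ cong (ℕ._+ 1) (cong₂ ℕ._+_ (sym (costs j)) (trans (sym (Σℕ-reflect F m)) (sym (costs j)))) ⟩
    C n m u j ℕ.+ C n m u j ℕ.+ 1                       ∎
  where
  open ℕP.≤-Reasoning
  F : ℕ → ℕ
  F p = ∣ X p - (j - q) * + n ∣
  termwise : ∀ p → p < suc m → g n (X p) ≤ F p ℕ.+ F (m ∸ p) ℕ.+ ind c p
  termwise p p≤m with pairs p (ℕP.≤-pred p≤m)
  ... | inj₁ sum = ℕP.≤-trans (g-pair n (X p) (X (m ∸ p)) (j - q) sum) (ℕP.m≤m+n _ _)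
  ... | inj₂ (sum , refl) = ℕP.≤-trans (g-pair+1 n (X p) (X (m ∸ p)) (j - q) sum)
                                       (ℕP.≤-reflexive (cong (F p ℕ.+ F (m ∸ p) ℕ.+_) (sym (ind-eq p))))

≡ᵇ-false : ∀ a b → ¬ a ≡ b → (a ℕ.≡ᵇ b) ≡ false
≡ᵇ-false zero zero ne = ⊥-elim (ne refl)
≡ᵇ-false zero (suc b) _ = refl
≡ᵇ-false (suc a) zero _ = refl
≡ᵇ-false (suc a) (suc b) ne = ≡ᵇ-false a b (ne ∘ cong suc)

≡ᵇ-refl : ∀ a → (a ℕ.≡ᵇ a) ≡ true
≡ᵇ-refl zero = refl
≡ᵇ-refl (suc a) = ≡ᵇ-refl a

if-middle : ∀ {m} {A : Set} (a b c : A) (j : Fin (suc (suc m))) i → toℕ j ≡ suc i → ¬ i ≡ m →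
            (if toℕ j ℕ.≡ᵇ 0 then a else (if toℕ j ℕ.≡ᵇ suc m then b else c)) ≡ c
if-middle {m} a b c j i e i≢m rewrite e | ≡ᵇ-false i m i≢m = refl

half-of-double : ∀ t e → e < 2 → (t ℕ.+ t ℕ.+ e) ℕ./ 2 ≡ t
half-of-double zero e e<2 = ℕDM.m<n⇒m/n≡0 e<2
half-of-double (suc t) e e<2 =
  trans (cong (ℕ._/ 2) (regroup t e)) (trans (ℕDM.m/n≡1+[m∸n]/n {2 ℕ.+ (t ℕ.+ t ℕ.+ e)} {2} (s≤s (s≤s z≤n)))
                                             (cong suc (half-of-double t e e<2)))
  where
  regroup : ∀ t e → suc t ℕ.+ suc t ℕ.+ e ≡ 2 ℕ.+ (t ℕ.+ t ℕ.+ e)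
  regroup = solveℕ

-- For m = n + 2t + e, both u⁰ and u¹ have middle coordinates 1 − w_i and first coordinate
-- ≡ −t (mod n); their reference profile is X_p = p − t − (w_1 + … + w_p).
module Extremal (n m : ℕ) .{{_ : NonZero n}} (t e : ℕ) (e<2 : e < 2) (m≡ : m ≡ n ℕ.+ (t ℕ.+ t) ℕ.+ e) where

  q : ℤ
  q = proj₁ (%ℕ-shift n (- + ((m ∸ n) ℕ./ 2)))

  first-coordinate : startVal n m ≡ - + t + q * + n
  first-coordinate = trans (proj₂ (%ℕ-shift n (- + ((m ∸ n) ℕ./ 2)))) (cong (λ w → - + w + q * + n) half-excess)
    where
    excess : m ∸ n ≡ t ℕ.+ t ℕ.+ e
    excess = trans (cong (_∸ n) (trans m≡ (ℕP.+-assoc n (t ℕ.+ t) e))) (ℕP.m+n∸m≡n n (t ℕ.+ t ℕ.+ e))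
    half-excess : (m ∸ n) ℕ./ 2 ≡ t
    half-excess = trans (cong (ℕ._/ 2) excess) (half-of-double t e e<2)

  mirror-sum : ∀ (B : ℕ → ℕ) p → p ≤ m →
               (+ p - + t - + B p) + (+ (m ∸ p) - + t - + B (m ∸ p)) ≡ + n + + e - + B p - + B (m ∸ p)
  mirror-sum B p p≤m = trans (regroup (+ p) (+ (m ∸ p)) (+ t) (+ B p) (+ B (m ∸ p)))
    (trans (cong (λ w → w - + t - + t - + B p - + B (m ∸ p)) (trans (sym (ℤP.pos-+ p (m ∸ p))) (cong +_ (trans (ℕP.m+[n∸m]≡n p≤m) m≡))))
           (trans (cong (λ w → w - + t - + t - + B p - + B (m ∸ p))
                        (trans (ℤP.pos-+ (n ℕ.+ (t ℕ.+ t)) e) (cong (_+ + e) (trans (ℤP.pos-+ n (t ℕ.+ t)) (cong (λ z → + n + z) (ℤP.pos-+ t t))))))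
                  (cancel (+ n) (+ t) (+ e) (+ B p) (+ B (m ∸ p)))))
    where
    regroup : ∀ a b t x y → a - t - x + (b - t - y) ≡ a + b - t - t - x - y
    regroup = solve-∀
    cancel : ∀ n t e x y → n + (t + t) + e - t - t - x - y ≡ n + e - x - y
    cancel = solve-∀

  profile-at-0 : ∀ (B : ℕ → ℕ) p D → B p ≡ 0 → p ℕ.+ D ≡ t → g n (+ p - + t - + B p) ≡ D ℕ.+ (D ℕ.+ n)
  profile-at-0 B p D B≡0 p+D≡t = trans (cong (g n) (trans (cong (λ w → + p - + t - + w) B≡0)
    (trans (ℤP.+-identityʳ _) (trans (cong (λ w → + p - + w) (sym p+D≡t)) (trans (cong (λ w → + p - w) (ℤP.pos-+ p D)) (cancel (+ p) (+ D)))))))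
    (g-at-−D n D)
    where
    cancel : ∀ p d → p - (p + d) ≡ - d
    cancel = solve-∀

  profile-at-n : ∀ (B : ℕ → ℕ) p D → B p ≡ e → t ℕ.+ n ℕ.+ e ℕ.+ D ≡ p → g n (+ p - + t - + B p) ≡ (D ℕ.+ n) ℕ.+ D
  profile-at-n B p D B≡e p≡ = trans (cong (g n) (trans (cong (λ w → + p - + t - + w) B≡e)
    (trans (cong (λ w → + w - + t - + e) (sym p≡)) (trans (cong (λ w → w - + t - + e) (expand t n e D)) (cancel (+ t) (+ n) (+ e) (+ D))))))
    (g-at-n+D n D)
    where
    expand : ∀ t n e D → + (t ℕ.+ n ℕ.+ e ℕ.+ D) ≡ + t + + n + + e + + D
    expand t n e D = trans (ℤP.pos-+ (t ℕ.+ n ℕ.+ e) D) (cong (_+ + D) (trans (ℤP.pos-+ (t ℕ.+ n) e) (cong (_+ + e) (ℤP.pos-+ t n))))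
    cancel : ∀ t n e d → t + n + e + d - t - e ≡ d + n
    cancel = solve-∀

  u⁰-entries : Fin (suc (suc m)) → ℤ
  u⁰-entries j = if toℕ j ℕ.≡ᵇ 0 then startVal n m else
                 (if toℕ j ℕ.≡ᵇ suc m then + ((- (startVal n m + + m)) %ℕ n) else + 1)

  u⁰-middle : ∀ i → 1 ≤ i → i ≤ m → co (u⁰ n m) i ≡ + 1 - + 0
  u⁰-middle (suc i) _ i≤m = trans (co-tabulate u⁰-entries (suc i) i<) (if-middle (startVal n m) (+ ((- (startVal n m + + m)) %ℕ n)) (+ 1) (Fin.fromℕ< i<) i (FinP.toℕ-fromℕ< i<) (ℕP.<⇒≢ i≤m))
    where
    i< : suc i < suc (suc m)
    i< = s≤s (ℕP.m≤n⇒m≤1+n i≤m)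

  u⁰-reference : e ≡ 0 → Reference n m t e (u⁰ n m)
  u⁰-reference e≡0 = record
    { X = X
    ; paired = paired-bound (u⁰ n m) X q 0 (cost-of-ones (u⁰ n m) (λ _ → 0) t q u⁰-middle first-coordinate) pairs
    ; at-0 = λ p D → profile-at-0 B p D (B≡0 p)
    ; at-n = λ p D → profile-at-n B p D (trans (B≡0 p) (sym e≡0)) }
    where
    B : ℕ → ℕ
    B = Σℕ (λ _ → 0)
    X : ℕ → ℤ
    X p = + p - + t - + B p
    B≡0 : ∀ p → B p ≡ 0
    B≡0 p = Σℕ-zero _ p (λ _ → refl)
    pairs : ∀ p → p ≤ m → (X p + X (m ∸ p) ≡ + n) ⊎ ((X p + X (m ∸ p) ≡ + n + + 1) × p ≡ 0)
    pairs p p≤m = inj₁ (trans (mirror-sum B p p≤m) (trans (cong₂ (λ a b → + n + + e - + a - + b) (B≡0 p) (B≡0 (m ∸ p)))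
                                                          (trans (cong (λ w → + n + + w - + 0 - + 0) e≡0) (cancel (+ n)))))
      where
      cancel : ∀ n → n + + 0 - + 0 - + 0 ≡ n
      cancel = solve-∀

  c : ℕ
  c = suc (suc m) ℕ./ 2

  u¹-entries : Fin (suc (suc m)) → ℤ
  u¹-entries j = if toℕ j ℕ.≡ᵇ 0 then startVal n m else
                 (if toℕ j ℕ.≡ᵇ suc m then + ((- (startVal n m + + m - + 1)) %ℕ n) else
                 (if toℕ j ℕ.≡ᵇ c then + 0 else + 1))

  u¹-middle : ∀ i → 1 ≤ i → i ≤ m → co (u¹ n m) i ≡ + 1 - + ind c i
  u¹-middle (suc i) _ i≤m =
    trans (co-tabulate u¹-entries (suc i) i<)
          (trans (if-middle (startVal n m) (+ ((- (startVal n m + + m - + 1)) %ℕ n)) (if toℕ (Fin.fromℕ< i<) ℕ.≡ᵇ c then + 0 else + 1) (Fin.fromℕ< i<) i (FinP.toℕ-fromℕ< i<) (ℕP.<⇒≢ i≤m))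
                 (trans (cong (λ r → if r ℕ.≡ᵇ c then + 0 else + 1) (FinP.toℕ-fromℕ< i<)) (at-c (suc i ℕ.≟ c))))
    where
    i< : suc i < suc (suc m)
    i< = s≤s (ℕP.m≤n⇒m≤1+n i≤m)
    at-c : Dec (suc i ≡ c) → (if suc i ℕ.≡ᵇ c then + 0 else + 1) ≡ + 1 - + ind c (suc i)
    at-c (yes e) = trans (cong (λ b → if b then + 0 else + 1) (trans (cong (ℕ._≡ᵇ c) e) (≡ᵇ-refl c)))
                         (cong (λ w → + 1 - + w) (sym (trans (cong (ind c) e) (ind-eq c))))
    at-c (no ≢c) = trans (cong (λ b → if b then + 0 else + 1) (≡ᵇ-false (suc i) c ≢c)) (cong (λ w → + 1 - + w) (sym (ind-ne c (suc i) ≢c)))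

  c-halves : ∃ λ c′ → c ≡ suc c′ × c′ ℕ.+ c′ ≤ m × m ≤ suc (c′ ℕ.+ c′)
  c-halves with c | ℕDM.m≡m%n+[m/n]*n (suc (suc m)) 2 | ℕDM.m%n<n (suc (suc m)) 2
  ... | zero | m+2≡ | r<2 = ⊥-elim (ℕP.<⇒≱ r<2 (ℕP.≤-trans (s≤s (s≤s z≤n)) (ℕP.≤-reflexive (trans m+2≡ (ℕP.+-identityʳ _)))))
  ... | suc c′ | m+2≡ | r<2 = c′ , refl , lower , upper
    where
    r = suc (suc m) ℕ.% 2
    doubling : ∀ c → suc c ℕ.* 2 ≡ suc (suc (c ℕ.+ c))
    doubling = solveℕ
    double = doubling c′
    lower : c′ ℕ.+ c′ ≤ m
    lower = ℕP.≤-pred (ℕP.≤-pred (ℕP.≤-trans (ℕP.≤-reflexive (sym double))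
                                             (ℕP.≤-trans (ℕP.m≤n+m _ r) (ℕP.≤-reflexive (sym m+2≡)))))
    upper : m ≤ suc (c′ ℕ.+ c′)
    upper = ℕP.≤-pred (ℕP.≤-pred (ℕP.≤-trans (ℕP.≤-reflexive m+2≡)
                                             (ℕP.≤-trans (ℕP.+-mono-≤ (ℕP.≤-pred r<2) (ℕP.≤-reflexive double)) (ℕP.≤-reflexive refl))))

  -- for m − n odd, X_p = p − t − [p > c′] and X_p + X_{m−p} = n except at p = c′, where it is n + 1
  module OddCase (e≡1 : e ≡ 1) where
    c′ : ℕ
    c′ = proj₁ c-halves
    c≡ : c ≡ suc c′
    c≡ = proj₁ (proj₂ c-halves)
    lower : c′ ℕ.+ c′ ≤ m
    lower = proj₁ (proj₂ (proj₂ c-halves))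
    upper : m ≤ suc (c′ ℕ.+ c′)
    upper = proj₂ (proj₂ (proj₂ c-halves))

    B : ℕ → ℕ
    B = Σℕ (ind c ∘ suc)
    X : ℕ → ℤ
    X p = + p - + t - + B p
    B≡ : ∀ p → B p ≡ Σℕ (ind c′) p
    B≡ p = Σℕ-cong p (λ i _ → trans (cong (λ w → ind w (suc i)) c≡) (ind-shift c′ i))
    B-low : ∀ p → p ≤ c′ → B p ≡ 0
    B-low p p≤c′ = trans (B≡ p) (Σind-below c′ p p≤c′)
    B-high : ∀ p → c′ < p → B p ≡ 1
    B-high p c′<p = trans (B≡ p) (Σind-above c′ p c′<p)

    m≡′ : m ≡ n ℕ.+ (t ℕ.+ t) ℕ.+ 1
    m≡′ = trans m≡ (cong (n ℕ.+ (t ℕ.+ t) ℕ.+_) e≡1)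

    -- the zones of the theorem lie on the correct sides of c′
    t≤c′ : t ≤ c′
    t≤c′ = halve t c′ (ℕP.≤-trans (ℕP.m≤n+m (t ℕ.+ t) n)
                                  (ℕP.≤-pred (ℕP.≤-trans (ℕP.≤-reflexive (trans (ℕP.+-comm 1 _) (sym m≡′))) upper)))
    c′≤t+n : c′ ≤ t ℕ.+ n
    c′≤t+n = halve c′ (t ℕ.+ n) (ℕP.≤-trans lower (ℕP.≤-trans (ℕP.≤-reflexive m≡′)
               (ℕP.≤-trans (ℕP.+-monoʳ-≤ (n ℕ.+ (t ℕ.+ t)) (ℕ.>-nonZero⁻¹ n)) (ℕP.≤-reflexive (regroup n t)))))
      where
      regroup : ∀ n t → n ℕ.+ (t ℕ.+ t) ℕ.+ n ≡ t ℕ.+ n ℕ.+ (t ℕ.+ n)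
      regroup = solveℕ
    beyond : ∀ p D → t ℕ.+ n ℕ.+ e ℕ.+ D ≡ p → c′ < p
    beyond p D p≡ = ℕP.<-≤-trans (s≤s c′≤t+n)
      (subst (suc (t ℕ.+ n) ≤_) p≡ (ℕP.≤-trans (ℕP.≤-reflexive (trans (ℕP.+-comm 1 (t ℕ.+ n)) (cong (t ℕ.+ n ℕ.+_) (sym e≡1)))) (ℕP.m≤m+n _ D)))

    pair-value : ∀ p → p ≤ m → X p + X (m ∸ p) ≡ + n + + 1 - + B p - + B (m ∸ p)
    pair-value p p≤m = trans (mirror-sum B p p≤m) (cong (λ w → + n + + w - + B p - + B (m ∸ p)) e≡1)

    -- exactly one of p, m − p exceeds c′, except for p = c′ when m = 2c′
    pairs : ∀ p → p ≤ m → (X p + X (m ∸ p) ≡ + n) ⊎ ((X p + X (m ∸ p) ≡ + n + + 1) × p ≡ c′)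
    pairs p p≤m with p ℕ.≤? c′ | (m ∸ p) ℕ.≤? c′
    ... | yes p≤c′ | yes p′≤c′ = inj₂ (trans (pair-value p p≤m) (trans (cong₂ (λ x y → + n + + 1 - + x - + y) (B-low p p≤c′) (B-low (m ∸ p) p′≤c′))
                                                                       (trans (ℤP.+-identityʳ _) (ℤP.+-identityʳ _)))
                                      , ℕP.≤-antisym p≤c′ c′≤p)
      where
      c′≤p : c′ ≤ p
      c′≤p = ℕP.≮⇒≥ (λ p<c′ → ℕP.<⇒≱ (ℕP.+-mono-<-≤ p<c′ p′≤c′) (ℕP.≤-trans lower (ℕP.≤-reflexive (sym (ℕP.m+[n∸m]≡n p≤m)))))
    ... | yes p≤c′ | no p′≰c′ = inj₁ (trans (pair-value p p≤m)
                                       (trans (cong₂ (λ x y → + n + + 1 - + x - + y) (B-low p p≤c′) (B-high (m ∸ p) (ℕP.≰⇒> p′≰c′))) (cancel (+ n))))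
      where
      cancel : ∀ n → n + + 1 - + 0 - + 1 ≡ n
      cancel = solve-∀
    ... | no p≰c′ | yes p′≤c′ = inj₁ (trans (pair-value p p≤m)
                                       (trans (cong₂ (λ x y → + n + + 1 - + x - + y) (B-high p (ℕP.≰⇒> p≰c′)) (B-low (m ∸ p) p′≤c′)) (cancel (+ n))))
      where
      cancel : ∀ n → n + + 1 - + 1 - + 0 ≡ n
      cancel = solve-∀
    ... | no p≰c′ | no p′≰c′ = ⊥-elim (ℕP.<⇒≱ (ℕP.≤-trans (s≤s upper) (ℕP.≤-trans (ℕP.≤-reflexive (sym (ℕP.+-suc (suc c′) c′)))
                                                (ℕP.+-mono-≤ (ℕP.≰⇒> p≰c′) (ℕP.≰⇒> p′≰c′))))
                                   (ℕP.≤-reflexive (ℕP.m+[n∸m]≡n p≤m)))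

    reference : Reference n m t e (u¹ n m)
    reference = record
      { X = X
      ; paired = paired-bound (u¹ n m) X q c′ (cost-of-ones (u¹ n m) (ind c) t q u¹-middle first-coordinate) pairs
      ; at-0 = λ p D p+D≡t → profile-at-0 B p D (B-low p (ℕP.≤-trans (subst (p ≤_) p+D≡t (ℕP.m≤m+n p D)) t≤c′)) p+D≡t
      ; at-n = λ p D p≡ → profile-at-n B p D (trans (B-high p (beyond p D p≡)) (sym e≡1)) p≡ }

  u¹-reference : e ≡ 1 → Reference n m t e (u¹ n m)
  u¹-reference = OddCase.reference

parity : ∀ k → ∃ λ t → k ≡ t ℕ.+ t ⊎ k ≡ suc (t ℕ.+ t)
parity zero = 0 , inj₁ refl
parity (suc k) with parity k
... | t , inj₁ k≡ = t , inj₂ (cong suc k≡)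
... | t , inj₂ k≡ = suc t , inj₁ (cong suc (trans k≡ (sym (ℕP.+-suc t t))))

evenCase-even : ∀ {a} {A : Set a} t (x y : A) → evenCase (t ℕ.+ t) x y ≡ x
evenCase-even zero x y = refl
evenCase-even (suc t) x y = trans (cong (λ k → evenCase (suc k) x y) (ℕP.+-suc t t)) (evenCase-even t x y)

evenCase-odd : ∀ {a} {A : Set a} t (x y : A) → evenCase (suc (t ℕ.+ t)) x y ≡ y
evenCase-odd zero x y = refl
evenCase-odd (suc t) x y = trans (cong (λ k → evenCase (suc (suc k)) x y) (ℕP.+-suc t t)) (evenCase-odd t x y)

DistanceOfU⁰ MaxDistance : (n m : ℕ) → .{{_ : NonZero n}} → ℕ → Set
DistanceOfU⁰ n m d = IsDist n m (u⁰ n m) (zeroV m) d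
MaxDistance n m d = ∃[ d₀ ] ∃[ d₁ ] IsDist n m (u⁰ n m) (zeroV m) d₀ × IsDist n m (u¹ n m) (zeroV m) d₁ × (d ≡ d₀ ℕ.⊔ d₁)

record Comparison (n m d : ℕ) : Set where
  field
    t e : ℕ
    m≡ : m ≡ n ℕ.+ (t ℕ.+ t) ℕ.+ e
    h≡ : h2nm n m ≡ n ℕ.+ e
    u : Tuple m
    reference : Reference n m t e u
    len : ℕ
    len≤d : len ≤ d
    walk : Walk n m u (zeroV m) len

comparison : ∀ n m .{{_ : NonZero n}} → n ≤ m → ∀ d → IsDnm n m d → Comparison n m d
comparison n m n≤m d isDnm with parity (m ∸ n)
... | t , inj₁ even = record
  { t = t ; e = 0 ; m≡ = m≡ ; h≡ = trans (cong (λ k → evenCase k n (suc n)) even) (trans (evenCase-even t n (suc n)) (sym (ℕP.+-identityʳ n)))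
  ; u = u⁰ n m ; reference = Extremal.u⁰-reference n m t 0 (s≤s z≤n) m≡ refl
  ; len = d ; len≤d = ℕP.≤-refl ; walk = proj₁ distance }
  where
  m≡ : m ≡ n ℕ.+ (t ℕ.+ t) ℕ.+ 0
  m≡ = trans (sym (ℕP.m+[n∸m]≡n n≤m)) (trans (cong (n ℕ.+_) even) (sym (ℕP.+-identityʳ _)))
  distance : DistanceOfU⁰ n m d
  distance = subst (λ S → S) (trans (cong (λ k → evenCase k (DistanceOfU⁰ n m d) (MaxDistance n m d)) even)
                                    (evenCase-even t _ _)) isDnm
... | t , inj₂ odd = record
  { t = t ; e = 1 ; m≡ = m≡ ; h≡ = trans (cong (λ k → evenCase k n (suc n)) odd) (trans (evenCase-odd t n (suc n)) (ℕP.+-comm 1 n))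
  ; u = u¹ n m ; reference = Extremal.u¹-reference n m t 1 ℕP.≤-refl m≡ refl
  ; len = d₁ ; len≤d = subst (d₁ ≤_) (sym d≡) (ℕP.m≤n⊔m d₀ d₁) ; walk = proj₁ dist₁ }
  where
  m≡ : m ≡ n ℕ.+ (t ℕ.+ t) ℕ.+ 1
  m≡ = trans (sym (ℕP.m+[n∸m]≡n n≤m)) (trans (cong (n ℕ.+_) odd) (regroup n t))
    where
    regroup : ∀ n t → n ℕ.+ suc (t ℕ.+ t) ≡ n ℕ.+ (t ℕ.+ t) ℕ.+ 1
    regroup = solveℕ
  distances : MaxDistance n m d
  distances = subst (λ S → S) (trans (cong (λ k → evenCase k (DistanceOfU⁰ n m d) (MaxDistance n m d)) odd)
                                     (evenCase-odd t _ _)) isDnm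
  d₀ = proj₁ distances
  d₁ = proj₁ (proj₂ distances)
  dist₁ = proj₁ (proj₂ (proj₂ (proj₂ distances)))
  d≡ = proj₂ (proj₂ (proj₂ (proj₂ distances)))

lemma5p27 : (n m : ℕ) → .{{_ : NonZero n}} → 1 < n → n ≤ m →
    (v : Tuple m) → IsVertex n m v →
    h2nm n m ≤ h2 n m v →
    sumIc n m v ≡ + n →
    (d : ℕ) → IsDnm n m d → DistLe n m v (zeroV m) d
lemma5p27 n m 1<n n≤m v isV h≥ Ic≡n d isDnm = DistLe-weaken (dominated v isV t e k zones reference walk) len≤d
  where
  open Comparison (comparison n m n≤m d isDnm)
  open CentralInterval v isV 1<n t e m≡ (subst (_≤ h2 n m v) h≡ h≥) Ic≡n using (k; zones)
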